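{- Let $\mathcal{H}=\bigcup_{i\in[t]}\bigcup_{j\in[\ell_i]}P_{i,j}$ be a coarse ear-decomposition in a graph $G$ of girth at least $5$. If $G-Z_{t,\ell_t}$ has an $\mathcal{H}$-path $Q$ of length at most $2$, then $t\ge2$, one end of $Q$ is in $V(H_{t-1,\ell_{t-1}})$ and the other is in $V(P_{t,1})$, and $P_{t,1}$ is of type 2.
   Context: Graphs are finite and simple; $[i]=\{1,\dots,i\}$. For $S\subseteq V(G)$ and $r\ge0$, $B_G(S,r)$ is the set of vertices at distance at most $r$ from $S$ in $G$. $V_{\ge3}(G)$ is the set of vertices of degree at least $3$ in $G$. For a subgraph $H$ of $G$, an $H$-path is a path in $G$ of length at least $1$ whose ends lie in $V(H)$, whose internal vertices are not in $V(H)$, and which shares no edge with $H$. Coarse ear-decomposition: for positive integers $t,\ell_1,\dots,\ell_t$, a subgraph $\mathcal{H}=\bigcup_{i\in[t]}\bigcup_{j\in[\ell_i]}P_{i,j}$ of $G$ such that, with $H_{0,0}$ the null graph, $\ell_0=0$, $Y_{0,0}=Z_{0,0}=\emptyset$, and for $i\in[t],j\in[\ell_i]$: $H_{i,j}=\bigl(\bigcup_{p\in[i-1]}\bigcup_{q\in[\ell_p]}P_{p,q}\bigr)\cup\bigcup_{r\in[j]}P_{i,r}$, $Y_{i,j}=B_{H_{i,j}}(V_{\ge3}(H_{i,j}),2)$, $Z_{i,j}=B_{G-(V(H_{i,j})\setminus Y_{i,j})}(Y_{i,j},1)$, the following hold. (A) For each $i\in[t]$, $G-Z_{i-1,\ell_{i-1}}$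 has no $H_{i-1,\ell_{i-1}}$-path. (B) For each $i\in[t]$: if $G-Z_{i-1,\ell_{i-1}}$ has a cycle meeting $V(H_{i-1,\ell_{i-1}})$ in exactly one vertex, then $P_{i,1}$ is a shortest such cycle (type 1); otherwise $P_{i,1}$ is a shortest cycle of $G-Z_{i-1,\ell_{i-1}}$ (type 2). (C) For each $i\in[t]$ and $j\in[\ell_i]\setminus\{1\}$, $P_{i,j}$ is a shortest $H_{i,j-1}$-path of $G-Z_{i,j-1}$. -}

module Defs where

open import Level using (0ℓ)
open import Data.Nat using (ℕ; zero; suc; _≤_; _<_; _∸_)
open import Data.Fin using (Fin; zero; suc; toℕ; inject₁; fromℕ)
open import Data.Product using (Σ; _×_; _,_; ∃)
open import Data.Sum using (_⊎_)
open import Data.Empty using (⊥)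
open import Relation.Nullary using (¬_; Dec)
open import Relation.Binary.PropositionalEquality using (_≡_; _≢_)

record Graph : Set₁ where
  field
    n       : ℕ
    Adj     : Fin n → Fin n → Set
    Adj-sym : ∀ {u v} → Adj u v → Adj v u
    Adj-irr : ∀ {v} → ¬ Adj v v
    Adj-dec : ∀ u v → Dec (Adj u v)
open Graph public

record Sub (G : Graph) : Set₁ where
  field
    V : Fin (n G) → Set
    E : Fin (n G) → Fin (n G) → Set
open Sub public

_─_ : (G : Graph) → (Fin (n G) → Set) → Sub G
G ─ X = record { V = λ v → ¬ X v ; E = λ u v → Adj G u v × ¬ X u × ¬ X v }

V≥3 : {G : Graph} → Sub G → Fin (n G) → Set
V≥3 H v = V H v × Σ _ λ a → Σ _ λ b → Σ _ λ c →
  E H v a × E H v b × E H v c × a ≢ b × a ≢ c × b ≢ c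

data Reach {G : Graph} (H : Sub G) (S : Fin (n G) → Set) : ℕ → Fin (n G) → Set where
  here : ∀ {r v} → S v → V H v → Reach H S r v
  step : ∀ {r u v} → Reach H S r u → E H u v → Reach H S (suc r) v

Ball : {G : Graph} → Sub G → (Fin (n G) → Set) → ℕ → Fin (n G) → Set
Ball H S r v = Reach H S r v

record Path (G : Graph) : Set where
  field
    len : ℕ
    vtx : Fin (suc len) → Fin (n G)
    inj : ∀ a b → vtx a ≡ vtx b → a ≡ b
    adj : ∀ (k : Fin len) → Adj G (vtx (inject₁ k)) (vtx (suc k))
open Path public

start end : {G : Graph} → Path G → Fin (n G)
start Q = vtx Q zero
end Q = vtx Q (fromℕ (len Q))

pathSub : {G : Graph} → Path G → Sub G
pathSub Q = record
  { V = λ v → Σ _ λ k → vtx Q k ≡ v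
  ; E = λ u v → Σ (Fin (len Q)) λ k →
          (vtx Q (inject₁ k) ≡ u × vtx Q (suc k) ≡ v)
        ⊎ (vtx Q (inject₁ k) ≡ v × vtx Q (suc k) ≡ u) }

-- a cycle with vertices cv 0 , … , cv m  (length suc m ≥ 3), edges between
-- consecutive ones and between cv m and cv 0
record Cycle (G : Graph) : Set where
  field
    m     : ℕ
    m≥2   : 2 ≤ m
    cv    : Fin (suc m) → Fin (n G)
    cinj  : ∀ a b → cv a ≡ cv b → a ≡ b
    cadj  : ∀ (k : Fin m) → Adj G (cv (inject₁ k)) (cv (suc k))
    close : Adj G (cv (fromℕ m)) (cv zero)
open Cycle public

clen : {G : Graph} → Cycle G → ℕ
clen C = suc (m C)

cycleSub : {G : Graph} → Cycle G → Sub G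
cycleSub C = record
  { V = λ v → Σ _ λ k → cv C k ≡ v
  ; E = λ u v →
        (Σ (Fin (m C)) λ k →
          (cv C (inject₁ k) ≡ u × cv C (suc k) ≡ v)
        ⊎ (cv C (inject₁ k) ≡ v × cv C (suc k) ≡ u))
      ⊎ ((cv C (fromℕ (m C)) ≡ u × cv C zero ≡ v)
        ⊎ (cv C (fromℕ (m C)) ≡ v × cv C zero ≡ u)) }

Girth≥5 : Graph → Set
Girth≥5 G = ∀ (C : Cycle G) → 5 ≤ clen C

PathAvoids : {G : Graph} → (Fin (n G) → Set) → Path G → Set
PathAvoids X Q = ∀ k → ¬ X (vtx Q k)

CycleAvoids : {G : Graph} → (Fin (n G) → Set) → Cycle G → Set
CycleAvoids X C = ∀ k → ¬ X (cv C k)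

IsHPath : {G : Graph} → Sub G → Path G → Set
IsHPath H Q =
  1 ≤ len Q × V H (start Q) × V H (end Q)
  × (∀ k → toℕ k ≢ 0 → toℕ k ≢ len Q → ¬ V H (vtx Q k))
  × (∀ (k : Fin (len Q)) → ¬ E H (vtx Q (inject₁ k)) (vtx Q (suc k)))

HasHPath : {G : Graph} → (Fin (n G) → Set) → Sub G → Set
HasHPath X H = Σ _ λ Q → PathAvoids X Q × IsHPath H Q

MeetsOnce : {G : Graph} → Sub G → Cycle G → Set
MeetsOnce H C = Σ _ λ v → V (cycleSub C) v × V H v
  × (∀ w → V (cycleSub C) w → V H w → w ≡ v)

-- Coarse ear-decompositions.
-- Ears are indexed by ℕ; only indices 1 ≤ i ≤ t, 1 ≤ j ≤ ℓ i are used.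
-- P_{i,1} = cyc i (a cycle), P_{i,j} = pth i j (a path) for j ≥ 2.

record EarData (G : Graph) : Set where
  field
    t   : ℕ
    ℓ   : ℕ → ℕ
    cyc : ℕ → Cycle G
    pth : ℕ → ℕ → Path G
open EarData public

ear : {G : Graph} → EarData G → ℕ → ℕ → Sub G
ear D i 1 = cycleSub (cyc D i)
ear D i j = pathSub (pth D i j)

InH : {G : Graph} → EarData G → ℕ → ℕ → ℕ → ℕ → Set
InH D i j p q = 1 ≤ p × 1 ≤ q × ((p < i × q ≤ ℓ D p) ⊎ (p ≡ i × q ≤ j))

HH : {G : Graph} → EarData G → ℕ → ℕ → Sub G
HH D i j = record
  { V = λ v → Σ ℕ λ p → Σ ℕ λ q → InH D i j p q × V (ear D p q) v
  ; E = λ u v → Σ ℕ λ p → Σ ℕ λ q → InH D i j p q × E (ear D p q) u v }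

YY : {G : Graph} → EarData G → ℕ → ℕ → Fin (n G) → Set
YY D i j = Ball (HH D i j) (V≥3 (HH D i j)) 2

ZZ : {G : Graph} → EarData G → ℕ → ℕ → Fin (n G) → Set
ZZ {G} D i j = Ball (G ─ (λ v → V (HH D i j) v × ¬ YY D i j v)) (YY D i j) 1

-- H_{i-1,ℓ_{i-1}} and Z_{i-1,ℓ_{i-1}}  (for i = 1 these are null / empty,
-- since InH requires p ≥ 1)
Hprev : {G : Graph} → EarData G → ℕ → Sub G
Hprev D i = HH D (i ∸ 1) (ℓ D (i ∸ 1))

Zprev : {G : Graph} → EarData G → ℕ → Fin (n G) → Set
Zprev D i = ZZ D (i ∸ 1) (ℓ D (i ∸ 1))

Type1Avail : {G : Graph} → EarData G → ℕ → Set
Type1Avail D i = Σ _ λ C → CycleAvoids (Zprev D i) C × MeetsOnce (Hprev D i) C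

Type2 : {G : Graph} → EarData G → ℕ → Set
Type2 D i = ¬ Type1Avail D i

record IsCoarseEarDecomp {G : Graph} (D : EarData G) : Set₁ where
  field
    t≥1  : 1 ≤ t D
    ℓ≥1  : ∀ i → 1 ≤ i → i ≤ t D → 1 ≤ ℓ D i
    condA : ∀ i → 1 ≤ i → i ≤ t D → ¬ HasHPath (Zprev D i) (Hprev D i)
    condB1 : ∀ i → 1 ≤ i → i ≤ t D → Type1Avail D i →
      CycleAvoids (Zprev D i) (cyc D i) × MeetsOnce (Hprev D i) (cyc D i)
      × (∀ (C : Cycle G) → CycleAvoids (Zprev D i) C → MeetsOnce (Hprev D i) C →
           clen (cyc D i) ≤ clen C)
    condB2 : ∀ i → 1 ≤ i → i ≤ t D → ¬ Type1Avail D i →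
      CycleAvoids (Zprev D i) (cyc D i)
      × (∀ (C : Cycle G) → CycleAvoids (Zprev D i) C → clen (cyc D i) ≤ clen C)
    condC : ∀ i j → 1 ≤ i → i ≤ t D → 2 ≤ j → j ≤ ℓ D i →
      PathAvoids (ZZ D i (j ∸ 1)) (pth D i j)
      × IsHPath (HH D i (j ∸ 1)) (pth D i j)
      × (∀ (Q : Path G) → PathAvoids (ZZ D i (j ∸ 1)) Q → IsHPath (HH D i (j ∸ 1)) Q →
           len (pth D i j) ≤ len Q)

{-# OPTIONS --safe #-}
module Submission where

-- If an end x of Q lies on a path ear
-- P_{t,j} (j ≥ 2) but not in H_{t,j−1}, then Q can be spliced into P_{t,j}, or can replace an end segment
-- of it, giving a shorter H_{t,j−1}-path of G − Z_{t,j−1} and contradicting (C): by girth ≥ 5, Q is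
-- shorter than the segment of P_{t,j} it closes a cycle with, and as x ∉ Y_{t,ℓ_t}, x is at distance at
-- least 3 from the ends of P_{t,j}, which have degree at least 3 in H_{t,ℓ_t}. So both ends lie in
-- H_{t,1}, and by (A) one of them, x, lies on P_{t,1} but not in H_{t−1,ℓ_{t−1}}. If the other end y were
-- on P_{t,1} as well, then Q and arcs of P_{t,1} would form a shorter cycle of the same type,
-- contradicting (B). Hence y ∈ H_{t−1,ℓ_{t−1}}, so t ≥ 2. Finally, if P_{t,1} were of type 1 with v its
-- vertex in H_{t−1,ℓ_{t−1}}, then v would have degree at least 3 in H_{t,ℓ_t}, so y ≠ v, and Q followed by
-- the arc of P_{t,1} from x to v would be an H_{t−1,ℓ_{t−1}}-path contradicting (A).

open import Defs
open import Data.Nat using (ℕ; zero; suc; _≤_; _<_; _∸_; _+_; z≤n; s≤s; s≤s⁻¹; _≤?_; _<?_; _≟_)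
open import Data.Nat.Properties
open import Data.Fin using (Fin; zero; suc; toℕ; inject₁; fromℕ; fromℕ<)
import Data.Fin.Properties as Fin
open import Data.Product using (_×_; ∃; _,_; proj₁; proj₂; uncurry)
open import Data.Sum using (_⊎_; inj₁; inj₂; [_,_]′)
import Data.Sum as Sum
open import Data.Empty using (⊥; ⊥-elim)
open import Relation.Nullary using (¬_; Dec; yes; no)
open import Relation.Nullary.Decidable using (map′; _×-dec_; _⊎-dec_)
open import Relation.Binary.PropositionalEquality
open import Function using (_∘_; id; flip; case_of_)
open import Relation.Binary.Definitions using (tri<; tri≈; tri>)

clamp : (L k : ℕ) → Fin (suc L)
clamp L       zero    = zero
clamp zero    (suc k) = zero
clamp (suc L) (suc k) = suc (clamp L k)

toℕ-clamp : ∀ L k → k ≤ L → toℕ (clamp L k) ≡ k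
toℕ-clamp L       zero    _         = refl
toℕ-clamp (suc L) (suc k) (s≤s k≤L) = cong suc (toℕ-clamp L k k≤L)

clamp-toℕ : ∀ L (i : Fin (suc L)) → clamp L (toℕ i) ≡ i
clamp-toℕ L       zero    = refl
clamp-toℕ (suc L) (suc i) = cong suc (clamp-toℕ L i)

clamp-self : ∀ L → clamp L L ≡ fromℕ L
clamp-self zero    = refl
clamp-self (suc L) = cong suc (clamp-self L)

inject₁-fromℕ<≡clamp : ∀ L k (k<L : k < L) → inject₁ (fromℕ< k<L) ≡ clamp L k
inject₁-fromℕ<≡clamp L k k<L = Fin.toℕ-injective (begin
  toℕ (inject₁ (fromℕ< k<L)) ≡⟨ Fin.toℕ-inject₁ (fromℕ< k<L) ⟩
  toℕ (fromℕ< k<L)           ≡⟨ Fin.toℕ-fromℕ< k<L ⟩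
  k                          ≡⟨ toℕ-clamp L k (<⇒≤ k<L) ⟨
  toℕ (clamp L k)            ∎)
  where open ≡-Reasoning

suc-fromℕ<≡clamp : ∀ L k (k<L : k < L) → suc (fromℕ< k<L) ≡ clamp L (suc k)
suc-fromℕ<≡clamp L k k<L =
  Fin.toℕ-injective (trans (cong suc (Fin.toℕ-fromℕ< k<L)) (sym (toℕ-clamp L (suc k) k<L)))

5≤m+n⇒n<m : ∀ {m n} → n ≤ 2 → 5 ≤ m + n → n < m
5≤m+n⇒n<m {m} n≤2 5≤m+n with m ≤? 2
... | yes m≤2 = ⊥-elim (<-irrefl refl (≤-trans 5≤m+n (+-mono-≤ m≤2 n≤2)))
... | no  m≰2 = ≤-<-trans n≤2 (≰⇒> m≰2)

-- A path as a total function ℕ → V that is only constrained on [0, size]; unlike Defs.Path,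
-- subpaths, reversals and concatenations then need no Fin arithmetic.
module NPaths (G : Graph) where

  Vertex : Set
  Vertex = Fin (n G)

  record NPath : Set where
    field
      size             : ℕ
      vertex           : ℕ → Vertex
      vertex-injective : ∀ {a b} → a ≤ size → b ≤ size → vertex a ≡ vertex b → a ≡ b
      vertex-adjacent  : ∀ {k} → k < size → Adj G (vertex k) (vertex (suc k))
  open NPath public

  first last : NPath → Vertex
  first R = vertex R 0
  last R = vertex R (size R)

  infix 4 _∈ᴾ_
  _∈ᴾ_ : Vertex → NPath → Set
  v ∈ᴾ R = ∃ λ k → k ≤ size R × vertex R k ≡ v

  Step : NPath → Vertex → Vertex → Set
  Step R u w = ∃ λ k → k < size R × vertex R k ≡ u × vertex R (suc k) ≡ w

  first-∈ : (R : NPath) → first R ∈ᴾ R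
  first-∈ R = 0 , z≤n , refl

  last-∈ : (R : NPath) → last R ∈ᴾ R
  last-∈ R = size R , ≤-refl , refl

  first≢last : (R : NPath) → 1 ≤ size R → first R ≢ last R
  first≢last R 1≤size eq = <⇒≢ 1≤size (vertex-injective R z≤n ≤-refl eq)

  1≤size : ∀ {x y} (R : NPath) → first R ≡ x → last R ≡ y → x ≢ y → 1 ≤ size R
  1≤size R first≡ last≡ x≢y =
    n≢0⇒n>0 (λ size≡0 → x≢y (trans (sym first≡) (trans (cong (vertex R) (sym size≡0)) last≡)))

  Step⇒≢ : ∀ {R u w} → Step R u w → u ≢ w
  Step⇒≢ {R} (k , k< , refl , refl) eq = Adj-irr G (subst (Adj G (vertex R k)) (sym eq) (vertex-adjacent R k<))

  last-step : (R : NPath) → 1 ≤ size R → Step R (vertex R (size R ∸ 1)) (last R)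
  last-step R 1≤size = size R ∸ 1 , ≤-reflexive suc[size∸1] , refl , cong (vertex R) suc[size∸1]
    where
    suc[size∸1] : suc (size R ∸ 1) ≡ size R
    suc[size∸1] = sym (+-∸-assoc 1 1≤size)

  segment : (R : NPath) (s l : ℕ) → s + l ≤ size R → NPath
  segment R s l s+l≤ = record
    { size             = l
    ; vertex           = λ k → vertex R (s + k)
    ; vertex-injective = λ a≤l b≤l eq → +-cancelˡ-≡ s _ _
        (vertex-injective R (inside a≤l) (inside b≤l) eq)
    ; vertex-adjacent  = λ {k} k<l → subst (Adj G (vertex R (s + k)) ∘ vertex R) (sym (+-suc s k))
        (vertex-adjacent R (≤-trans (+-monoʳ-< s k<l) s+l≤)) }
    where
    inside : ∀ {k} → k ≤ l → s + k ≤ size R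
    inside k≤l = ≤-trans (+-monoʳ-≤ s k≤l) s+l≤

  segment-first : ∀ R s l (s+l≤ : s + l ≤ size R) → first (segment R s l s+l≤) ≡ vertex R s
  segment-first R s l s+l≤ = cong (vertex R) (+-identityʳ s)

  ∈-segment⁻ : ∀ R s l (s+l≤ : s + l ≤ size R) {v} → v ∈ᴾ segment R s l s+l≤ →
               ∃ λ k → s ≤ k × k ≤ s + l × vertex R k ≡ v
  ∈-segment⁻ R s l s+l≤ (k , k≤l , eq) = s + k , m≤m+n s k , +-monoʳ-≤ s k≤l , eq

  ∈-segment⇒∈ : ∀ R s l (s+l≤ : s + l ≤ size R) {v} → v ∈ᴾ segment R s l s+l≤ → v ∈ᴾ R
  ∈-segment⇒∈ R s l s+l≤ v∈ with ∈-segment⁻ R s l s+l≤ v∈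
  ... | k , _ , k≤ , eq = k , ≤-trans k≤ s+l≤ , eq

  ∈-segment⁺ : ∀ R s l (s+l≤ : s + l ≤ size R) {k} → s ≤ k → k ≤ s + l →
               vertex R k ∈ᴾ segment R s l s+l≤
  ∈-segment⁺ R s l s+l≤ {k} s≤k k≤ =
    k ∸ s , ≤-trans (∸-monoˡ-≤ s k≤) (≤-reflexive (m+n∸m≡n s l)) , cong (vertex R) (m+[n∸m]≡n s≤k)

  ∈-segment-index : ∀ R s l (s+l≤ : s + l ≤ size R) {k} → k ≤ size R →
                    vertex R k ∈ᴾ segment R s l s+l≤ → s ≤ k × k ≤ s + l
  ∈-segment-index R s l s+l≤ k≤ v∈ with ∈-segment⁻ R s l s+l≤ v∈
  ... | i , s≤i , i≤ , eq with vertex-injective R (≤-trans i≤ s+l≤) k≤ eq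
  ...   | refl = s≤i , i≤

  Step-segment⁻ : ∀ R s l (s+l≤ : s + l ≤ size R) {u w} → Step (segment R s l s+l≤) u w → Step R u w
  Step-segment⁻ R s l s+l≤ (k , k<l , eq₁ , eq₂) =
    s + k , ≤-trans (+-monoʳ-< s k<l) s+l≤ , eq₁ , trans (cong (vertex R) (sym (+-suc s k))) eq₂

  reverse : NPath → NPath
  reverse R = record
    { size             = size R
    ; vertex           = λ k → vertex R (size R ∸ k)
    ; vertex-injective = λ {a} {b} a≤ b≤ eq →
        ∸-cancelˡ-≡ a≤ b≤ (vertex-injective R (m∸n≤m _ a) (m∸n≤m _ b) eq)
    ; vertex-adjacent  = λ {k} k< → subst (λ i → Adj G (vertex R i) (vertex R (size R ∸ suc k)))
        (sym (+-∸-assoc 1 k<)) (Adj-sym G (vertex-adjacent R (∸-monoʳ-< (s≤s z≤n) k<))) }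

  reverse-last : ∀ R → last (reverse R) ≡ first R
  reverse-last R = cong (vertex R) (n∸n≡0 (size R))

  ∈-reverse⁻ : ∀ R {v} → v ∈ᴾ reverse R → v ∈ᴾ R
  ∈-reverse⁻ R (k , _ , eq) = size R ∸ k , m∸n≤m _ k , eq

  ∈-reverse⁺ : ∀ R {v} → v ∈ᴾ R → v ∈ᴾ reverse R
  ∈-reverse⁺ R (k , k≤ , eq) = size R ∸ k , m∸n≤m _ k , trans (cong (vertex R) (m∸[m∸n]≡n k≤)) eq

  Step-reverse⁻ : ∀ R {u w} → Step (reverse R) u w → Step R w u
  Step-reverse⁻ R (k , k< , eq₁ , eq₂) =
    size R ∸ suc k , ∸-monoʳ-< (s≤s z≤n) k< , eq₂ , trans (cong (vertex R) (sym (+-∸-assoc 1 k<))) eq₁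

  SharesOnlyLast : NPath → NPath → Set
  SharesOnlyLast A B = ∀ {v} → v ∈ᴾ A → v ∈ᴾ B → v ≡ last A

  joinVertex : NPath → NPath → ℕ → Vertex
  joinVertex A B k with k ≤? size A
  ... | yes _ = vertex A k
  ... | no  _ = vertex B (k ∸ size A)

  joinVertex-≤ : ∀ A B {k} → k ≤ size A → joinVertex A B k ≡ vertex A k
  joinVertex-≤ A B {k} k≤ with k ≤? size A
  ... | yes _ = refl
  ... | no  k≰ = ⊥-elim (k≰ k≤)

  joinVertex-+ : ∀ A B → last A ≡ first B → ∀ l → joinVertex A B (size A + l) ≡ vertex B l
  joinVertex-+ A B glue zero =
    trans (joinVertex-≤ A B (≤-reflexive (+-identityʳ _))) (trans (cong (vertex A) (+-identityʳ _)) glue)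
  joinVertex-+ A B glue (suc l) with size A + suc l ≤? size A
  ... | yes ≤A = ⊥-elim (m+1+n≰m (size A) ≤A)
  ... | no  _  = cong (vertex B) (m+n∸m≡n (size A) (suc l))

  data JoinIndex (A B : NPath) (k : ℕ) : Set where
    left  : k ≤ size A → JoinIndex A B k
    right : ∀ l → 1 ≤ l → l ≤ size B → k ≡ size A + l → JoinIndex A B k

  joinIndex : ∀ A B k → k ≤ size A + size B → JoinIndex A B k
  joinIndex A B k k≤ with k ≤? size A
  ... | yes k≤A = left k≤A
  ... | no  k≰A = right (k ∸ size A) (m<n⇒0<n∸m (≰⇒> k≰A))
      (≤-trans (∸-monoˡ-≤ (size A) k≤) (≤-reflexive (m+n∸m≡n (size A) (size B))))
      (sym (m+[n∸m]≡n (<⇒≤ (≰⇒> k≰A))))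

  joinStep : ∀ A B k → k < size A + size B → k < size A ⊎ ∃ λ l → l < size B × k ≡ size A + l
  joinStep A B k k< with size A ≤? k
  ... | no  A≰k = inj₁ (≰⇒> A≰k)
  ... | yes A≤k = inj₂ (k ∸ size A , +-cancelˡ-< (size A) _ _ (subst (_< size A + size B) k≡ k<) , k≡)
    where
    k≡ : k ≡ size A + (k ∸ size A)
    k≡ = sym (m+[n∸m]≡n A≤k)

  module _ (A B : NPath) (glue : last A ≡ first B) where

    joinVertex-at : ∀ {k} l → k ≡ size A + l → joinVertex A B k ≡ vertex B l
    joinVertex-at l refl = joinVertex-+ A B glue l

    only-first-shared : SharesOnlyLast A B → ∀ {k l} → k ≤ size A → 1 ≤ l → l ≤ size B →
                        vertex A k ≢ vertex B l
    only-first-shared shares {k} {l} k≤A 1≤l l≤B eq = <⇒≢ 1≤l (sym (vertex-injective B l≤B z≤n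
      (trans (sym eq) (trans (shares (k , k≤A , refl) (l , l≤B , sym eq)) glue))))

    join-injective : SharesOnlyLast A B → ∀ {a b} → a ≤ size A + size B → b ≤ size A + size B →
                     joinVertex A B a ≡ joinVertex A B b → a ≡ b
    join-injective shares {a} {b} a≤ b≤ eq with joinIndex A B a a≤ | joinIndex A B b b≤
    ... | left a≤A | left b≤A =
      vertex-injective A a≤A b≤A (trans (sym (joinVertex-≤ A B a≤A)) (trans eq (joinVertex-≤ A B b≤A)))
    ... | left a≤A | right l 1≤l l≤B b≡ =
      ⊥-elim (only-first-shared shares a≤A 1≤l l≤B
        (trans (sym (joinVertex-≤ A B a≤A)) (trans eq (joinVertex-at l b≡))))
    ... | right l 1≤l l≤B a≡ | left b≤A =
      ⊥-elim (only-first-shared shares b≤A 1≤l l≤B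
        (trans (sym (joinVertex-≤ A B b≤A)) (trans (sym eq) (joinVertex-at l a≡))))
    ... | right l _ l≤B a≡ | right l′ _ l′≤B b≡ =
      trans a≡ (trans (cong (size A +_) (vertex-injective B l≤B l′≤B
        (trans (sym (joinVertex-at l a≡)) (trans eq (joinVertex-at l′ b≡))))) (sym b≡))

    join-adjacent : ∀ {k} → k < size A + size B → Adj G (joinVertex A B k) (joinVertex A B (suc k))
    join-adjacent {k} k< with joinStep A B k k<
    ... | inj₁ k<A = subst₂ (Adj G) (sym (joinVertex-≤ A B (<⇒≤ k<A))) (sym (joinVertex-≤ A B k<A))
                       (vertex-adjacent A k<A)
    ... | inj₂ (l , l<B , k≡) = subst₂ (Adj G) (sym (joinVertex-at l k≡))
                       (sym (joinVertex-at (suc l) (trans (cong suc k≡) (sym (+-suc (size A) l)))))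
                       (vertex-adjacent B l<B)

  join : (A B : NPath) → last A ≡ first B → SharesOnlyLast A B → NPath
  join A B glue shares = record
    { size             = size A + size B
    ; vertex           = joinVertex A B
    ; vertex-injective = join-injective A B glue shares
    ; vertex-adjacent  = join-adjacent A B glue }

  module _ (A B : NPath) (glue : last A ≡ first B) (shares : SharesOnlyLast A B) where

    join-first : first (join A B glue shares) ≡ first A
    join-first = joinVertex-≤ A B z≤n

    join-last : last (join A B glue shares) ≡ last B
    join-last = joinVertex-+ A B glue (size B)

    ∈-join⁻ : ∀ {v} → v ∈ᴾ join A B glue shares → v ∈ᴾ A ⊎ v ∈ᴾ B
    ∈-join⁻ (k , k≤ , eq) with joinIndex A B k k≤
    ... | left k≤A           = inj₁ (k , k≤A , trans (sym (joinVertex-≤ A B k≤A)) eq)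
    ... | right l _ l≤B k≡ = inj₂ (l , l≤B , trans (sym (joinVertex-at A B glue l k≡)) eq)

    ∈-join⁺ˡ : ∀ {v} → v ∈ᴾ A → v ∈ᴾ join A B glue shares
    ∈-join⁺ˡ (k , k≤ , eq) = k , ≤-trans k≤ (m≤m+n _ _) , trans (joinVertex-≤ A B k≤) eq

    ∈-join⁺ʳ : ∀ {v} → v ∈ᴾ B → v ∈ᴾ join A B glue shares
    ∈-join⁺ʳ (l , l≤ , eq) = size A + l , +-monoʳ-≤ (size A) l≤ , trans (joinVertex-+ A B glue l) eq

    Step-join⁻ : ∀ {u w} → Step (join A B glue shares) u w → Step A u w ⊎ Step B u w
    Step-join⁻ (k , k< , eq₁ , eq₂) with joinStep A B k k<
    ... | inj₁ k<A = inj₁ (k , k<A , trans (sym (joinVertex-≤ A B (<⇒≤ k<A))) eq₁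
                                    , trans (sym (joinVertex-≤ A B k<A)) eq₂)
    ... | inj₂ (l , l<B , k≡) = inj₂ (l , l<B , trans (sym (joinVertex-at A B glue l k≡)) eq₁
        , trans (sym (joinVertex-at A B glue (suc l) (trans (cong suc k≡) (sym (+-suc (size A) l))))) eq₂)

  edge : (u w : Vertex) → Adj G u w → NPath
  edge u w u~w = record
    { size             = 1
    ; vertex           = ends
    ; vertex-injective = injective
    ; vertex-adjacent  = λ { {zero} _ → u~w ; {suc _} (s≤s ()) } }
    where
    ends : ℕ → Vertex
    ends zero    = u
    ends (suc _) = w

    injective : ∀ {a b} → a ≤ 1 → b ≤ 1 → ends a ≡ ends b → a ≡ b
    injective {zero}        {zero}        _        _        _  = refl
    injective {zero}        {suc zero}    _        _        eq = ⊥-elim (Adj-irr G (subst (Adj G u) (sym eq) u~w))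
    injective {suc zero}    {zero}        _        _        eq = ⊥-elim (Adj-irr G (subst (Adj G u) eq u~w))
    injective {suc zero}    {suc zero}    _        _        _  = refl
    injective {suc (suc _)} {_}           (s≤s ()) _        _
    injective {_}           {suc (suc _)} _        (s≤s ()) _

  ∈-edge⁻ : ∀ u w (u~w : Adj G u w) {v} → v ∈ᴾ edge u w u~w → v ≡ u ⊎ v ≡ w
  ∈-edge⁻ u w u~w (zero  , _ , eq) = inj₁ (sym eq)
  ∈-edge⁻ u w u~w (suc _ , _ , eq) = inj₂ (sym eq)

  Step-edge⁻ : ∀ u w (u~w : Adj G u w) {x y} → Step (edge u w u~w) x y → x ≡ u × y ≡ w
  Step-edge⁻ u w u~w (zero  , _ , eq₁ , eq₂) = sym eq₁ , sym eq₂
  Step-edge⁻ u w u~w (suc _ , s≤s () , _)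

  module _ (L : ℕ) (f : Fin (suc L) → Vertex) (f-injective : ∀ a b → f a ≡ f b → a ≡ b)
           (f-adjacent : ∀ (k : Fin L) → Adj G (f (inject₁ k)) (f (suc k))) where

    fromFin : NPath
    fromFin = record
      { size             = L
      ; vertex           = f ∘ clamp L
      ; vertex-injective = λ {a} {b} a≤ b≤ eq → trans (sym (toℕ-clamp L a a≤))
          (trans (cong toℕ (f-injective _ _ eq)) (toℕ-clamp L b b≤))
      ; vertex-adjacent  = λ {k} k< → subst₂ (λ i j → Adj G (f i) (f j))
          (inject₁-fromℕ<≡clamp L k k<) (suc-fromℕ<≡clamp L k k<) (f-adjacent (fromℕ< k<)) }

    fromFin-last : last fromFin ≡ f (fromℕ L)
    fromFin-last = cong f (clamp-self L)

    ∈-fromFin⁺ : ∀ {v} → (∃ λ i → f i ≡ v) → v ∈ᴾ fromFin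
    ∈-fromFin⁺ (i , eq) = toℕ i , Fin.toℕ≤pred[n] i , trans (cong f (clamp-toℕ L i)) eq

    ∈-fromFin⁻ : ∀ {v} → v ∈ᴾ fromFin → ∃ λ i → f i ≡ v
    ∈-fromFin⁻ (k , _ , eq) = clamp L k , eq

    Step-fromFin⁻ : ∀ {u w} → Step fromFin u w → ∃ λ (k : Fin L) → f (inject₁ k) ≡ u × f (suc k) ≡ w
    Step-fromFin⁻ (k , k< , eq₁ , eq₂) = fromℕ< k<
      , trans (cong f (inject₁-fromℕ<≡clamp L k k<)) eq₁ , trans (cong f (suc-fromℕ<≡clamp L k k<)) eq₂

  fromPath : Path G → NPath
  fromPath P = fromFin (len P) (vtx P) (inj P) (adj P)

  fromCycle : Cycle G → NPath
  fromCycle C = fromFin (m C) (cv C) (cinj C) (cadj C)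

  module _ (P : Path G) where

    fromPath-last : last (fromPath P) ≡ end P
    fromPath-last = fromFin-last (len P) (vtx P) (inj P) (adj P)

    ∈-fromPath⁺ : ∀ {v} → V (pathSub P) v → v ∈ᴾ fromPath P
    ∈-fromPath⁺ = ∈-fromFin⁺ (len P) (vtx P) (inj P) (adj P)

    ∈-fromPath⁻ : ∀ {v} → v ∈ᴾ fromPath P → V (pathSub P) v
    ∈-fromPath⁻ = ∈-fromFin⁻ (len P) (vtx P) (inj P) (adj P)

    Step-fromPath⁻ : ∀ {u w} → Step (fromPath P) u w → E (pathSub P) u w
    Step-fromPath⁻ st with Step-fromFin⁻ (len P) (vtx P) (inj P) (adj P) st
    ... | k , eq₁ , eq₂ = k , inj₁ (eq₁ , eq₂)

    pathSub-E-sym : ∀ {u w} → E (pathSub P) u w → E (pathSub P) w u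
    pathSub-E-sym (k , eqs) = k , Sum.swap eqs

    pathSub-E⇒V : ∀ {u w} → E (pathSub P) u w → V (pathSub P) w
    pathSub-E⇒V (k , inj₁ (_ , eq)) = suc k , eq
    pathSub-E⇒V (k , inj₂ (eq , _)) = inject₁ k , eq

  module _ (C : Cycle G) where

    ∈-fromCycle⁺ : ∀ {v} → V (cycleSub C) v → v ∈ᴾ fromCycle C
    ∈-fromCycle⁺ = ∈-fromFin⁺ (m C) (cv C) (cinj C) (cadj C)

    ∈-fromCycle⁻ : ∀ {v} → v ∈ᴾ fromCycle C → V (cycleSub C) v
    ∈-fromCycle⁻ = ∈-fromFin⁻ (m C) (cv C) (cinj C) (cadj C)

    Step-fromCycle⁻ : ∀ {u w} → Step (fromCycle C) u w → E (cycleSub C) u w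
    Step-fromCycle⁻ st with Step-fromFin⁻ (m C) (cv C) (cinj C) (cadj C) st
    ... | k , eq₁ , eq₂ = inj₁ (k , inj₁ (eq₁ , eq₂))

    fromCycle-closing : Adj G (first (fromCycle C)) (last (fromCycle C))
    fromCycle-closing =
      subst (Adj G (cv C zero)) (sym (fromFin-last (m C) (cv C) (cinj C) (cadj C))) (Adj-sym G (close C))

    closing-E : E (cycleSub C) (first (fromCycle C)) (last (fromCycle C))
    closing-E = inj₂ (inj₂ (cong (cv C) (sym (clamp-self (m C))) , refl))

    cycleSub-E-sym : ∀ {u w} → E (cycleSub C) u w → E (cycleSub C) w u
    cycleSub-E-sym (inj₁ (k , eqs)) = inj₁ (k , Sum.swap eqs)
    cycleSub-E-sym (inj₂ eqs)       = inj₂ (Sum.swap eqs)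

    cycleSub-E⇒V : ∀ {u w} → E (cycleSub C) u w → V (cycleSub C) w
    cycleSub-E⇒V (inj₁ (k , inj₁ (_ , eq))) = suc k , eq
    cycleSub-E⇒V (inj₁ (k , inj₂ (eq , _))) = inject₁ k , eq
    cycleSub-E⇒V (inj₂ (inj₁ (_ , eq)))     = zero , eq
    cycleSub-E⇒V (inj₂ (inj₂ (eq , _)))     = fromℕ (m C) , eq

  CycleAvoids-∉ : ∀ {X : Vertex → Set} {C : Cycle G} {v} → CycleAvoids X C → V (cycleSub C) v → ¬ X v
  CycleAvoids-∉ avoid (k , refl) = avoid k

  toPath : NPath → Path G
  toPath R = record
    { len = size R
    ; vtx = vertex R ∘ toℕ
    ; inj = λ a b eq → Fin.toℕ-injective (vertex-injective R (Fin.toℕ≤pred[n] a) (Fin.toℕ≤pred[n] b) eq)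
    ; adj = λ k → subst (λ i → Adj G (vertex R i) (vertex R (suc (toℕ k)))) (sym (Fin.toℕ-inject₁ k))
                    (vertex-adjacent R (Fin.toℕ<n k)) }

  toCycle : (R : NPath) → 2 ≤ size R → Adj G (last R) (first R) → Cycle G
  toCycle R 2≤size closing = record
    { m     = size R
    ; m≥2   = 2≤size
    ; cv    = vertex R ∘ toℕ
    ; cinj  = inj (toPath R)
    ; cadj  = adj (toPath R)
    ; close = subst (λ i → Adj G (vertex R i) (first R)) (sym (Fin.toℕ-fromℕ (size R))) closing }

  module _ (R : NPath) (2≤size : 2 ≤ size R) (closing : Adj G (last R) (first R)) where

    ∈-toCycle⁻ : ∀ {v} → V (cycleSub (toCycle R 2≤size closing)) v → v ∈ᴾ R
    ∈-toCycle⁻ (k , eq) = toℕ k , Fin.toℕ≤pred[n] k , eq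

    ∈-toCycle⁺ : ∀ {v} → v ∈ᴾ R → V (cycleSub (toCycle R 2≤size closing)) v
    ∈-toCycle⁺ (k , k≤ , eq) = clamp _ k , trans (cong (vertex R) (toℕ-clamp _ k k≤)) eq

  infix 4 _⊑_
  _⊑_ : Sub G → Sub G → Set
  H ⊑ H′ = (∀ {v} → V H v → V H′ v) × (∀ {u w} → E H u w → E H′ u w)

  record Within (H : Sub G) (A : NPath) : Set where
    field
      vertices-in : ∀ {v} → v ∈ᴾ A → V H v
      steps-in    : ∀ {u w} → Step A u w → E H u w
  open Within public

  module _ {H : Sub G} where

    Within-mono : ∀ {H′ A} → H ⊑ H′ → Within H A → Within H′ A
    Within-mono (V⊆ , E⊆) w = record { vertices-in = V⊆ ∘ vertices-in w ; steps-in = E⊆ ∘ steps-in w }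

    Within-segment : ∀ {R} s l (s+l≤ : s + l ≤ size R) → Within H R → Within H (segment R s l s+l≤)
    Within-segment {R} s l s+l≤ w = record
      { vertices-in = vertices-in w ∘ ∈-segment⇒∈ R s l s+l≤
      ; steps-in    = steps-in w ∘ Step-segment⁻ R s l s+l≤ }

    Within-reverse : (∀ {u w} → E H u w → E H w u) → ∀ {R} → Within H R → Within H (reverse R)
    Within-reverse E-sym {R} w = record
      { vertices-in = vertices-in w ∘ ∈-reverse⁻ R
      ; steps-in    = E-sym ∘ steps-in w ∘ Step-reverse⁻ R }

    Within-join : ∀ {A B} {glue : last A ≡ first B} {shares : SharesOnlyLast A B} →
                  Within H A → Within H B → Within H (join A B glue shares)
    Within-join {A} {B} {glue} {shares} wA wB = record
      { vertices-in = [ vertices-in wA , vertices-in wB ]′ ∘ ∈-join⁻ A B glue shares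
      ; steps-in    = [ steps-in wA , steps-in wB ]′ ∘ Step-join⁻ A B glue shares }

  Within-fromPath : ∀ P → Within (pathSub P) (fromPath P)
  Within-fromPath P = record { vertices-in = ∈-fromPath⁻ P ; steps-in = Step-fromPath⁻ P }

  Within-fromCycle : ∀ C → Within (cycleSub C) (fromCycle C)
  Within-fromCycle C = record { vertices-in = ∈-fromCycle⁻ C ; steps-in = Step-fromCycle⁻ C }

  Inner∉ : Sub G → NPath → Set
  Inner∉ H R = ∀ {v} → v ∈ᴾ R → v ≢ first R → v ≢ last R → ¬ V H v

  Steps∉ : Sub G → NPath → Set
  Steps∉ H R = ∀ {u w} → Step R u w → ¬ E H u w

  Avoids : (Vertex → Set) → NPath → Set
  Avoids X R = ∀ {v} → v ∈ᴾ R → ¬ X v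

  module _ {H : Sub G} where

    Inner∉-segment : ∀ R s l (s+l≤ : s + l ≤ size R) → Inner∉ H R → Inner∉ H (segment R s l s+l≤)
    Inner∉-segment R s l s+l≤ inner v∈ v≢first v≢last with ∈-segment⁻ R s l s+l≤ v∈
    ... | k , s≤k , k≤s+l , refl = inner (k , k≤size , refl) ≢first ≢last
      where
      k≤size : k ≤ size R
      k≤size = ≤-trans k≤s+l s+l≤
      ≢first : vertex R k ≢ first R
      ≢first eq = v≢first (cong (vertex R) (trans k≡0 (sym s+0≡0)))
        where
        k≡0 : k ≡ 0
        k≡0 = vertex-injective R k≤size z≤n eq
        s+0≡0 : s + 0 ≡ 0
        s+0≡0 = trans (+-identityʳ s) (n≤0⇒n≡0 (≤-trans s≤k (≤-reflexive k≡0)))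
      ≢last : vertex R k ≢ last R
      ≢last eq = v≢last (cong (vertex R) (≤-antisym k≤s+l (≤-trans s+l≤ (≤-reflexive (sym k≡size)))))
        where
        k≡size : k ≡ size R
        k≡size = vertex-injective R k≤size ≤-refl eq

    Inner∉-reverse : ∀ {R} → Inner∉ H R → Inner∉ H (reverse R)
    Inner∉-reverse {R} inner v∈ v≢first v≢last =
      inner (∈-reverse⁻ R v∈) (v≢last ∘ flip trans (sym (reverse-last R))) v≢first

    Inner∉-join : ∀ A B (glue : last A ≡ first B) (shares : SharesOnlyLast A B) →
                  Inner∉ H A → Inner∉ H B → ¬ V H (last A) → Inner∉ H (join A B glue shares)
    Inner∉-join A B glue shares innerA innerB middle {v} v∈ v≢first v≢last
      with ∈-join⁻ A B glue shares v∈
    ... | inj₁ v∈A with v Fin.≟ last A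
    ...   | yes refl = middle
    ...   | no  v≢   = innerA v∈A (v≢first ∘ flip trans (sym (join-first A B glue shares))) v≢
    Inner∉-join A B glue shares innerA innerB middle {v} v∈ v≢first v≢last
        | inj₂ v∈B with v Fin.≟ first B
    ...   | yes refl = subst (¬_ ∘ V H) glue middle
    ...   | no  v≢   = innerB v∈B v≢ (v≢last ∘ flip trans (sym (join-last A B glue shares)))

    Steps∉-join : ∀ A B (glue : last A ≡ first B) (shares : SharesOnlyLast A B) →
                  Steps∉ H A → Steps∉ H B → Steps∉ H (join A B glue shares)
    Steps∉-join A B glue shares stepsA stepsB = [ stepsA , stepsB ]′ ∘ Step-join⁻ A B glue shares

  Avoids-join : ∀ {X} A B (glue : last A ≡ first B) (shares : SharesOnlyLast A B) →
                Avoids X A → Avoids X B → Avoids X (join A B glue shares)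
  Avoids-join A B glue shares avoidsA avoidsB = [ avoidsA , avoidsB ]′ ∘ ∈-join⁻ A B glue shares

  record HPath (H : Sub G) (X : Vertex → Set) (R : NPath) : Set where
    field
      nontrivial : 1 ≤ size R
      first∈H    : V H (first R)
      last∈H     : V H (last R)
      inner∉H    : Inner∉ H R
      steps∉H    : Steps∉ H R
      avoids     : Avoids X R
  open HPath public

  module _ {H : Sub G} {X : Vertex → Set} where

    HPath⇒IsHPath : ∀ {R} → HPath H X R → PathAvoids X (toPath R) × IsHPath H (toPath R)
    HPath⇒IsHPath {R} h =
      (λ k → avoids h (toℕ k , Fin.toℕ≤pred[n] k , refl)) ,
      nontrivial h , first∈H h ,
      subst (V H ∘ vertex R) (sym (Fin.toℕ-fromℕ (size R))) (last∈H h) ,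
      (λ k k≢0 k≢len → inner∉H h (toℕ k , Fin.toℕ≤pred[n] k , refl)
         (k≢0 ∘ vertex-injective R (Fin.toℕ≤pred[n] k) z≤n)
         (k≢len ∘ vertex-injective R (Fin.toℕ≤pred[n] k) ≤-refl)) ,
      (λ k → subst (λ i → ¬ E H (vertex R i) (vertex R (suc (toℕ k)))) (sym (Fin.toℕ-inject₁ k))
         (steps∉H h (toℕ k , Fin.toℕ<n k , refl , refl)))

    IsHPath⇒HPath : ∀ P → PathAvoids X P → IsHPath H P → HPath H X (fromPath P)
    IsHPath⇒HPath P avoid (1≤len , start∈H , end∈H , inner , steps) = record
      { nontrivial = 1≤len
      ; first∈H    = start∈H
      ; last∈H     = subst (V H) (sym (fromPath-last P)) end∈H
      ; inner∉H    = λ { (k , k≤ , refl) k≢first k≢last → inner (clamp _ k)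
                           (λ k≡0 → k≢first (cong (vtx P) (Fin.toℕ-injective k≡0)))
                           (λ k≡len → k≢last (cong (vtx P) (Fin.toℕ-injective
                              (trans k≡len (sym (toℕ-clamp _ _ ≤-refl)))))) }
      ; steps∉H    = λ st → case Step-fromFin⁻ (len P) (vtx P) (inj P) (adj P) st of
                       λ { (k , refl , refl) → steps k }
      ; avoids     = λ { (k , _ , refl) → avoid (clamp _ k) } }

    HPath-reverse : (∀ {u w} → E H u w → E H w u) → ∀ {R} → HPath H X R → HPath H X (reverse R)
    HPath-reverse E-sym {R} h = record
      { nontrivial = nontrivial h
      ; first∈H    = last∈H h
      ; last∈H     = subst (V H) (sym (reverse-last R)) (first∈H h)
      ; inner∉H    = Inner∉-reverse {H} {R} (inner∉H h)
      ; steps∉H    = λ st e → steps∉H h (Step-reverse⁻ R st) (E-sym e)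
      ; avoids     = avoids h ∘ ∈-reverse⁻ R }

  module Closing (A B : NPath) (glue₁ : last A ≡ first B) (glue₂ : last B ≡ first A)
                 (shares : ∀ {v} → v ∈ᴾ A → v ∈ᴾ B → v ≡ first A ⊎ v ≡ last A)
                 (1≤A : 1 ≤ size A) (1≤B : 1 ≤ size B)
                 (no-shared-step : ∀ {u w} → Step A u w → ¬ Step B w u) where

    private
      suc[B∸1] : suc (size B ∸ 1) ≡ size B
      suc[B∸1] = sym (+-∸-assoc 1 1≤B)

      B⁻≤ : 0 + (size B ∸ 1) ≤ size B
      B⁻≤ = m∸n≤m (size B) 1

      B⁻ : NPath
      B⁻ = segment B 0 (size B ∸ 1) B⁻≤

      shares⁻ : SharesOnlyLast A B⁻
      shares⁻ v∈A (l , l≤ , eq) with shares v∈A (∈-segment⇒∈ B 0 (size B ∸ 1) B⁻≤ (l , l≤ , eq))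
      ... | inj₂ v≡last  = v≡last
      ... | inj₁ v≡first = ⊥-elim (<⇒≢ (≤-trans (s≤s l≤) (≤-reflexive suc[B∸1]))
              (vertex-injective B (≤-trans l≤ B⁻≤) ≤-refl (trans eq (trans v≡first (sym glue₂)))))

      R : NPath
      R = join A B⁻ glue₁ shares⁻

      suc[size] : suc (size R) ≡ size A + size B
      suc[size] = trans (sym (+-suc (size A) _)) (cong (size A +_) suc[B∸1])

      3≤size : 3 ≤ size A + size B
      3≤size with 2 ≤? size A | 2 ≤? size B
      ... | yes 2≤A | _       = +-mono-≤ 2≤A 1≤B
      ... | no  _   | yes 2≤B = +-mono-≤ 1≤A 2≤B
      ... | no  2≰A | no  2≰B = ⊥-elim (no-shared-step (0 , 1≤A , refl , refl)
              (0 , 1≤B , trans (sym glue₁) (cong (vertex A) A≡1) , trans (cong (vertex B) (sym B≡1)) glue₂))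
        where
        A≡1 : size A ≡ 1
        A≡1 = ≤-antisym (s≤s⁻¹ (≰⇒> 2≰A)) 1≤A
        B≡1 : size B ≡ 1
        B≡1 = ≤-antisym (s≤s⁻¹ (≰⇒> 2≰B)) 1≤B

      2≤size : 2 ≤ size R
      2≤size = s≤s⁻¹ (subst (3 ≤_) (sym suc[size]) 3≤size)

      closing : Adj G (last R) (first R)
      closing = subst₂ (Adj G) (sym (join-last A B⁻ glue₁ shares⁻))
        (trans (cong (vertex B) suc[B∸1]) (trans glue₂ (sym (join-first A B⁻ glue₁ shares⁻))))
        (vertex-adjacent B (≤-reflexive suc[B∸1]))

    cycle : Cycle G
    cycle = toCycle R 2≤size closing

    cycle-clen : clen cycle ≡ size A + size B
    cycle-clen = suc[size]

    ∈-cycle⁻ : ∀ {v} → V (cycleSub cycle) v → v ∈ᴾ A ⊎ v ∈ᴾ B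
    ∈-cycle⁻ =
      Sum.map₂ (∈-segment⇒∈ B 0 (size B ∸ 1) B⁻≤) ∘ ∈-join⁻ A B⁻ glue₁ shares⁻ ∘ ∈-toCycle⁻ R 2≤size closing

    ∈-cycle⁺ˡ : ∀ {v} → v ∈ᴾ A → V (cycleSub cycle) v
    ∈-cycle⁺ˡ = ∈-toCycle⁺ R 2≤size closing ∘ ∈-join⁺ˡ A B⁻ glue₁ shares⁻

  record Arcs (C : Cycle G) (x y : Vertex) : Set where
    field
      arc₁ arc₂  : NPath
      arc₁-first : first arc₁ ≡ x
      arc₁-last  : last arc₁ ≡ y
      arc₂-first : first arc₂ ≡ x
      arc₂-last  : last arc₂ ≡ y
      arcs-size  : size arc₁ + size arc₂ ≡ clen C
      arc₁-within : Within (cycleSub C) arc₁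
      arc₂-within : Within (cycleSub C) arc₂
      arcs-meet  : ∀ {v} → v ∈ᴾ arc₁ → v ∈ᴾ arc₂ → v ≡ x ⊎ v ≡ y
      arcs-cover : ∀ {v} → V (cycleSub C) v → v ∈ᴾ arc₁ ⊎ v ∈ᴾ arc₂

  arcs-swap : ∀ {C x y} → Arcs C x y → Arcs C x y
  arcs-swap a = record
    { arc₁ = arc₂ ; arc₂ = arc₁
    ; arc₁-first = arc₂-first ; arc₁-last = arc₂-last ; arc₂-first = arc₁-first ; arc₂-last = arc₁-last
    ; arcs-size = trans (+-comm (size arc₂) (size arc₁)) arcs-size
    ; arc₁-within = arc₂-within ; arc₂-within = arc₁-within
    ; arcs-meet = flip arcs-meet ; arcs-cover = Sum.swap ∘ arcs-cover }
    where open Arcs a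

  arcs-flip : ∀ {C x y} → Arcs C x y → Arcs C y x
  arcs-flip {C} a = record
    { arc₁ = reverse arc₁ ; arc₂ = reverse arc₂
    ; arc₁-first = arc₁-last ; arc₁-last = trans (reverse-last arc₁) arc₁-first
    ; arc₂-first = arc₂-last ; arc₂-last = trans (reverse-last arc₂) arc₂-first
    ; arcs-size = arcs-size
    ; arc₁-within = Within-reverse (cycleSub-E-sym C) arc₁-within
    ; arc₂-within = Within-reverse (cycleSub-E-sym C) arc₂-within
    ; arcs-meet = λ v∈₁ v∈₂ → Sum.swap (arcs-meet (∈-reverse⁻ arc₁ v∈₁) (∈-reverse⁻ arc₂ v∈₂))
    ; arcs-cover = Sum.map (∈-reverse⁺ arc₁) (∈-reverse⁺ arc₂) ∘ arcs-cover }
    where open Arcs a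

  -- The arcs between the vertices c_a and c_b (a < b) of the cycle c_0 … c_M are c_a … c_b and
  -- c_a … c_0 c_M … c_b.
  module ArcsBetween (C : Cycle G) (a b : ℕ) (a<b : a < b) (b≤M : b ≤ m C) where

    private
      C⁰ : NPath
      C⁰ = fromCycle C

      M : ℕ
      M = m C

      c : ℕ → Vertex
      c = vertex C⁰

      a≤b : a ≤ b
      a≤b = <⇒≤ a<b

      a≤M : a ≤ M
      a≤M = ≤-trans a≤b b≤M

      IndexIn : (ℕ → Set) → Vertex → Set
      IndexIn P v = ∃ λ k → P k × k ≤ M × c k ≡ v

      straight≤ : a + (b ∸ a) ≤ M
      straight≤ = ≤-trans (≤-reflexive (m+[n∸m]≡n a≤b)) b≤M

      B≤ : b + (M ∸ b) ≤ M
      B≤ = ≤-reflexive (m+[n∸m]≡n b≤M)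

      straight : NPath
      straight = segment C⁰ a (b ∸ a) straight≤

      ∈straight⁻ : ∀ {v} → v ∈ᴾ straight → IndexIn (λ k → a ≤ k × k ≤ b) v
      ∈straight⁻ v∈ with ∈-segment⁻ C⁰ a (b ∸ a) straight≤ v∈
      ... | k , a≤k , k≤ , eq =
        k , (a≤k , ≤-trans k≤ (≤-reflexive (m+[n∸m]≡n a≤b))) , ≤-trans k≤ straight≤ , eq

      low : NPath
      low = segment C⁰ 0 a a≤M

      down : NPath
      down = reverse low

      ∈down⁻ : ∀ {v} → v ∈ᴾ down → IndexIn (_≤ a) v
      ∈down⁻ v∈ with ∈-segment⁻ C⁰ 0 a a≤M (∈-reverse⁻ low v∈)
      ... | k , _ , k≤a , eq = k , k≤a , ≤-trans k≤a a≤M , eq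

      wrap : NPath
      wrap = edge (c 0) (c M) (fromCycle-closing C)

      high : NPath
      high = segment C⁰ b (M ∸ b) B≤

      top : NPath
      top = reverse high

      ∈top⁻ : ∀ {v} → v ∈ᴾ top → IndexIn (b ≤_) v
      ∈top⁻ v∈ with ∈-segment⁻ C⁰ b (M ∸ b) B≤ (∈-reverse⁻ high v∈)
      ... | k , b≤k , k≤ , eq = k , b≤k , ≤-trans k≤ B≤ , eq

      wrap-glue : last wrap ≡ first top
      wrap-glue = cong c (sym (m+[n∸m]≡n b≤M))

      wrap-shares : SharesOnlyLast wrap top
      wrap-shares v∈wrap v∈top with ∈-edge⁻ _ _ (fromCycle-closing C) v∈wrap | ∈top⁻ v∈top
      ... | inj₂ v≡cM | _ = v≡cM
      ... | inj₁ v≡c0 | k , b≤k , k≤M , eq =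
        ⊥-elim (<⇒≢ (<-≤-trans (≤-<-trans z≤n a<b) b≤k)
          (vertex-injective C⁰ z≤n k≤M (sym (trans eq v≡c0))))

      tail : NPath
      tail = join wrap top wrap-glue wrap-shares

      ∈tail⁻ : ∀ {v} → v ∈ᴾ tail → IndexIn (λ k → k ≡ 0 ⊎ b ≤ k) v
      ∈tail⁻ v∈ with ∈-join⁻ wrap top wrap-glue wrap-shares v∈
      ... | inj₂ v∈top with ∈top⁻ v∈top
      ...   | k , b≤k , rest = k , inj₂ b≤k , rest
      ∈tail⁻ v∈ | inj₁ v∈wrap with ∈-edge⁻ _ _ (fromCycle-closing C) v∈wrap
      ...   | inj₁ v≡c0 = 0 , inj₁ refl , z≤n , sym v≡c0
      ...   | inj₂ v≡cM = M , inj₂ b≤M , ≤-refl , sym v≡cM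

      down-glue : last down ≡ first tail
      down-glue = trans (reverse-last low) (sym (join-first wrap top wrap-glue wrap-shares))

      down-shares : SharesOnlyLast down tail
      down-shares v∈down v∈tail with ∈down⁻ v∈down | ∈tail⁻ v∈tail
      ... | _ | _ , inj₁ refl , _ , eq = trans (sym eq) (sym (reverse-last low))
      ... | k , k≤a , k≤M , eq | k′ , inj₂ b≤k′ , k′≤M , eq′ =
        ⊥-elim (<⇒≱ (≤-<-trans k≤a a<b) (≤-trans b≤k′ (≤-reflexive
          (vertex-injective C⁰ k′≤M k≤M (trans eq′ (sym eq))))))

      around : NPath
      around = join down tail down-glue down-shares

      ∈around⁻ : ∀ {v} → v ∈ᴾ around → IndexIn (λ k → k ≤ a ⊎ b ≤ k) v
      ∈around⁻ v∈ with ∈-join⁻ down tail down-glue down-shares v∈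
      ... | inj₁ v∈down = case ∈down⁻ v∈down of λ { (k , k≤a , rest) → k , inj₁ k≤a , rest }
      ... | inj₂ v∈tail with ∈tail⁻ v∈tail
      ...   | k , inj₁ refl , rest = k , inj₁ z≤n , rest
      ...   | k , inj₂ b≤k , rest  = k , inj₂ b≤k , rest

      wrap-within : Within (cycleSub C) wrap
      wrap-within = record
        { vertices-in = [ (λ { refl → ∈-fromCycle⁻ C (first-∈ C⁰) }) , (λ { refl → ∈-fromCycle⁻ C (last-∈ C⁰) }) ]′
                        ∘ ∈-edge⁻ _ _ (fromCycle-closing C)
        ; steps-in    = λ st → case Step-edge⁻ _ _ (fromCycle-closing C) st of
                          λ { (refl , refl) → closing-E C } }

      around-within : Within (cycleSub C) around
      around-within =
        Within-join (Within-reverse (cycleSub-E-sym C) (Within-segment 0 a a≤M (Within-fromCycle C)))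
          (Within-join wrap-within
            (Within-reverse (cycleSub-E-sym C) (Within-segment b (M ∸ b) B≤ (Within-fromCycle C))))

      sizes : (b ∸ a) + (a + (1 + (M ∸ b))) ≡ suc M
      sizes = begin
        (b ∸ a) + (a + (1 + (M ∸ b)))  ≡⟨ +-assoc (b ∸ a) a _ ⟨
        (b ∸ a) + a + (1 + (M ∸ b))    ≡⟨ cong (_+ (1 + (M ∸ b))) (m∸n+n≡m a≤b) ⟩
        b + (1 + (M ∸ b))              ≡⟨ +-suc b (M ∸ b) ⟩
        suc (b + (M ∸ b))              ≡⟨ cong suc (m+[n∸m]≡n b≤M) ⟩
        suc M                          ∎
        where open ≡-Reasoning

      meet : ∀ {v} → v ∈ᴾ straight → v ∈ᴾ around → v ≡ c a ⊎ v ≡ c b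
      meet v∈straight v∈around with ∈straight⁻ v∈straight | ∈around⁻ v∈around
      ... | k , (a≤k , k≤b) , k≤M , eq | k′ , side , k′≤M , eq′
          with vertex-injective C⁰ k≤M k′≤M (trans eq (sym eq′))
      ... | refl with side
      ...   | inj₁ k≤a = inj₁ (trans (sym eq) (cong c (≤-antisym k≤a a≤k)))
      ...   | inj₂ b≤k = inj₂ (trans (sym eq) (cong c (≤-antisym k≤b b≤k)))

      cover : ∀ {v} → V (cycleSub C) v → v ∈ᴾ straight ⊎ v ∈ᴾ around
      cover v∈C with ∈-fromCycle⁺ C v∈C
      ... | k , k≤M , refl with k <? a | b <? k
      ...   | yes k<a | _ = inj₂ (∈-join⁺ˡ down tail down-glue down-shares
                (∈-reverse⁺ low (∈-segment⁺ C⁰ 0 a a≤M z≤n (<⇒≤ k<a))))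
      ...   | no _ | yes b<k = inj₂ (∈-join⁺ʳ down tail down-glue down-shares
                (∈-join⁺ʳ wrap top wrap-glue wrap-shares
                  (∈-reverse⁺ high (∈-segment⁺ C⁰ b (M ∸ b) B≤ (<⇒≤ b<k)
                    (≤-trans k≤M (≤-reflexive (sym (m+[n∸m]≡n b≤M))))))))
      ...   | no k≮a | no b≮k = inj₁ (∈-segment⁺ C⁰ a (b ∸ a) straight≤ (≮⇒≥ k≮a)
                (≤-trans (≮⇒≥ b≮k) (≤-reflexive (sym (m+[n∸m]≡n a≤b)))))

    arcs : Arcs C (c a) (c b)
    arcs = record
      { arc₁ = straight ; arc₂ = around
      ; arc₁-first = segment-first C⁰ a (b ∸ a) straight≤
      ; arc₁-last  = cong c (m+[n∸m]≡n a≤b)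
      ; arc₂-first = join-first down tail down-glue down-shares
      ; arc₂-last  = trans (join-last down tail down-glue down-shares)
          (trans (join-last wrap top wrap-glue wrap-shares)
            (trans (reverse-last high) (segment-first C⁰ b (M ∸ b) B≤)))
      ; arcs-size  = sizes
      ; arc₁-within = Within-segment a (b ∸ a) straight≤ (Within-fromCycle C)
      ; arc₂-within = around-within
      ; arcs-meet  = meet
      ; arcs-cover = cover }

  arcs : (C : Cycle G) {x y : Vertex} → V (cycleSub C) x → V (cycleSub C) y → x ≢ y → Arcs C x y
  arcs C x∈C y∈C x≢y with ∈-fromCycle⁺ C x∈C | ∈-fromCycle⁺ C y∈C
  ... | a , a≤M , refl | b , b≤M , refl with <-cmp a b
  ...   | tri< a<b _ _  = ArcsBetween.arcs C a b a<b b≤M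
  ...   | tri≈ _ refl _ = ⊥-elim (x≢y refl)
  ...   | tri> _ _ b<a  = arcs-flip (ArcsBetween.arcs C b a b<a a≤M)

module Subgraphs (G : Graph) where
  open NPaths G

  Reach-mono : ∀ {H H′ S S′ r v} → H ⊑ H′ → (∀ {x} → S x → S′ x) → Reach H S r v → Reach H′ S′ r v
  Reach-mono H⊑ S⊆ (here s v∈)  = here (S⊆ s) (proj₁ H⊑ v∈)
  Reach-mono H⊑ S⊆ (step ρ e)   = step (Reach-mono H⊑ S⊆ ρ) (proj₂ H⊑ e)

  Reach-weaken : ∀ {H : Sub G} {S : Vertex → Set} {r r′ v} → r ≤ r′ → Reach H S r v → Reach H S r′ v
  Reach-weaken r≤        (here s v∈) = here s v∈
  Reach-weaken (s≤s r≤)  (step ρ e)  = step (Reach-weaken r≤ ρ) e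

  Reach-along : ∀ {H : Sub G} {S : Vertex → Set} {R} → Within H R → S (first R) →
                ∀ k → k ≤ size R → Reach H S k (vertex R k)
  Reach-along {R = R} R⊆H s zero    _  = here s (vertices-in R⊆H (first-∈ R))
  Reach-along         R⊆H s (suc k) k< =
    step (Reach-along R⊆H s k (<⇒≤ k<)) (steps-in R⊆H (k , k< , refl , refl))

  V≥3-mono : ∀ {H H′ v} → H ⊑ H′ → V≥3 H v → V≥3 H′ v
  V≥3-mono (V⊆ , E⊆) (v∈ , a , b , c , ea , eb , ec , a≢b , a≢c , b≢c) =
    V⊆ v∈ , a , b , c , E⊆ ea , E⊆ eb , E⊆ ec , a≢b , a≢c , b≢c

  Y : Sub G → Vertex → Set
  Y H = Reach H (V≥3 H) 2

  Z : Sub G → Vertex → Set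
  Z H = Reach (G ─ (λ v → V H v × ¬ Y H v)) (Y H) 1

  Y-mono : ∀ {H H′ v} → H ⊑ H′ → Y H v → Y H′ v
  Y-mono H⊑ = Reach-mono H⊑ (V≥3-mono H⊑)

  Y⊆Z : ∀ {H v} → Y H v → Z H v
  Y⊆Z y = here y (λ (_ , ¬y) → ¬y y)

  ∉Z-of-∈∖Y : ∀ {H v} → V H v → ¬ Y H v → ¬ Z H v
  ∉Z-of-∈∖Y v∈ ¬y (here _ ¬out)            = ¬out (v∈ , ¬y)
  ∉Z-of-∈∖Y v∈ ¬y (step _ (_ , _ , ¬out)) = ¬out (v∈ , ¬y)

  -- Z H is not monotone in H, but Z H ⊆ Z H′ holds outside V H′.
  ∉Z-outside : ∀ {H H′ v} → H ⊑ H′ → ¬ V H′ v → ¬ Z H′ v → ¬ Z H v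
  ∉Z-outside H⊑ v∉ ¬z (here y _) = ¬z (Y⊆Z (Y-mono H⊑ y))
  ∉Z-outside {H′ = H′} H⊑ v∉ ¬z (step {u = u} (here y _) (u~v , _ , _)) =
    ¬z (step (here y′ (λ (_ , ¬y) → ¬y y′)) (u~v , (λ (_ , ¬y) → ¬y y′) , (λ (v∈ , _) → v∉ v∈)))
    where
    y′ : Y H′ u
    y′ = Y-mono H⊑ y

  ∉Z-shrink : ∀ {H H′ v} → H′ ⊑ H → V H′ v → ¬ Z H v → ¬ Z H′ v
  ∉Z-shrink H′⊑ v∈ ¬z = ∉Z-of-∈∖Y v∈ (¬z ∘ Y⊆Z ∘ Y-mono H′⊑)

  HPath-avoids-shrink : ∀ {H H′ R} → H′ ⊑ H → HPath H (Z H) R → ¬ Z H′ (first R) → ¬ Z H′ (last R) →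
                        Avoids (Z H′) R
  HPath-avoids-shrink {R = R} H′⊑ h first∉ last∉ {v} v∈ with v Fin.≟ first R | v Fin.≟ last R
  ... | yes refl | _        = first∉
  ... | no  _    | yes refl = last∉
  ... | no  ≢f   | no  ≢l   = ∉Z-outside H′⊑ (inner∉H h v∈ ≢f ≢l) (avoids h v∈)

  HPath-shrink : ∀ {H H′ R} → H′ ⊑ H → HPath H (Z H) R → V H′ (first R) → V H′ (last R) →
                 HPath H′ (Z H′) R
  HPath-shrink {R = R} H′⊑ h first∈ last∈ = record
    { nontrivial = nontrivial h
    ; first∈H    = first∈
    ; last∈H     = last∈
    ; inner∉H    = λ v∈ ≢f ≢l → inner∉H h v∈ ≢f ≢l ∘ proj₁ H′⊑
    ; steps∉H    = λ st → steps∉H h st ∘ proj₂ H′⊑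
    ; avoids     = HPath-avoids-shrink H′⊑ h (∉Z-shrink H′⊑ first∈ (avoids h (first-∈ R)))
                                              (∉Z-shrink H′⊑ last∈ (avoids h (last-∈ R))) }

  TwoNeighbours : Sub G → Vertex → Set
  TwoNeighbours H v = ∃ λ a → ∃ λ b → E H v a × E H v b × a ≢ b

  TwoNeighbours-mono : ∀ {H H′ v} → H ⊑ H′ → TwoNeighbours H v → TwoNeighbours H′ v
  TwoNeighbours-mono (_ , E⊆) (a , b , ea , eb , a≢b) = a , b , E⊆ ea , E⊆ eb , a≢b

  V≥3-extend : ∀ {H H′ v c} → H′ ⊑ H → V H′ v → TwoNeighbours H′ v → E H v c → ¬ E H′ v c → V≥3 H v
  V≥3-extend (V⊆ , E⊆) v∈ (a , b , ea , eb , a≢b) ec ¬ec =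
    V⊆ v∈ , a , b , _ , E⊆ ea , E⊆ eb , ec , a≢b , (λ { refl → ¬ec ea }) , (λ { refl → ¬ec eb })

  HPath-first-V≥3 : ∀ {H H′ X R} → H′ ⊑ H → HPath H′ X R → TwoNeighbours H′ (first R) →
                    (∀ {u w} → Step R u w → E H u w) → V≥3 H (first R)
  HPath-first-V≥3 {R = R} H′⊑ h two steps-in =
    V≥3-extend H′⊑ (first∈H h) two (steps-in first-step) (steps∉H h first-step)
    where
    first-step : Step R (first R) (vertex R 1)
    first-step = 0 , nontrivial h , refl , refl

  module _ (C : Cycle G) where

    private
      C⁰ : NPath
      C⁰ = fromCycle C

      c : ℕ → Vertex
      c = vertex C⁰

    cycle-TwoNeighbours : ∀ {v} → V (cycleSub C) v → TwoNeighbours (cycleSub C) v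
    cycle-TwoNeighbours v∈ with ∈-fromCycle⁺ C v∈
    ... | zero , _ , refl =
      c 1 , c (m C) , Step-fromCycle⁻ C (0 , <⇒≤ (m≥2 C) , refl , refl) , closing-E C ,
      <⇒≢ (m≥2 C) ∘ vertex-injective C⁰ (<⇒≤ (m≥2 C)) ≤-refl
    ... | suc k , k<M , refl with suc k <? m C
    ...   | yes k+1<M =
      c k , c (suc (suc k)) , cycleSub-E-sym C (Step-fromCycle⁻ C (k , k<M , refl , refl)) ,
      Step-fromCycle⁻ C (suc k , k+1<M , refl , refl) ,
      <⇒≢ (≤-trans (n<1+n k) (n≤1+n (suc k))) ∘ vertex-injective C⁰ (<⇒≤ k<M) k+1<M
    ...   | no k+1≮M =
      c k , c 0 , cycleSub-E-sym C (Step-fromCycle⁻ C (k , k<M , refl , refl)) ,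
      subst (λ i → E (cycleSub C) (c i) (c 0)) (sym k+1≡M) (cycleSub-E-sym C (closing-E C)) ,
      k≢0 ∘ vertex-injective C⁰ (<⇒≤ k<M) z≤n
      where
      k+1≡M : suc k ≡ m C
      k+1≡M = ≤-antisym k<M (≮⇒≥ k+1≮M)
      k≢0 : k ≢ 0
      k≢0 refl = <⇒≢ (m≥2 C) k+1≡M

  module _ (P : Path G) where

    private
      p : ℕ → Vertex
      p = vertex (fromPath P)

    inner-TwoNeighbours : ∀ k → 0 < k → k < len P → TwoNeighbours (pathSub P) (p k)
    inner-TwoNeighbours (suc k) _ k+1<len =
      p k , p (suc (suc k)) , pathSub-E-sym P (Step-fromPath⁻ P (k , <⇒≤ k+1<len , refl , refl)) ,
      Step-fromPath⁻ P (suc k , k+1<len , refl , refl) ,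
      <⇒≢ (≤-trans (n<1+n k) (n≤1+n (suc k))) ∘
        vertex-injective (fromPath P) (≤-trans (n≤1+n k) (<⇒≤ k+1<len)) k+1<len

  path-TwoNeighbours : ∀ {H H′} (P : Path G) → H′ ⊑ H → pathSub P ⊑ H → V H′ (start P) → V H′ (end P) →
    (∀ {w} → V H′ w → TwoNeighbours H′ w) → ∀ {v} → V (pathSub P) v → TwoNeighbours H v
  path-TwoNeighbours {H′ = H′} P H′⊑ P⊑ start∈ end∈ H′-two v∈ with ∈-fromPath⁺ P v∈
  ... | zero , _ , refl = TwoNeighbours-mono H′⊑ (H′-two start∈)
  ... | suc k , k≤ , refl with suc k <? len P
  ...   | yes k<len = TwoNeighbours-mono P⊑ (inner-TwoNeighbours P (suc k) (s≤s z≤n) k<len)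
  ...   | no  k≮len = TwoNeighbours-mono H′⊑ (H′-two (subst (V H′) (sym v≡end) end∈))
    where
    v≡end : vertex (fromPath P) (suc k) ≡ end P
    v≡end = trans (cong (vertex (fromPath P)) (≤-antisym k≤ (≮⇒≥ k≮len))) (fromPath-last P)

module EarDecomposition (G : Graph) (D : EarData G) (dc : IsCoarseEarDecomp D) where
  open NPaths G
  open Subgraphs G
  open IsCoarseEarDecomp dc

  ear-E-sym : ∀ p q {u w} → E (ear D p q) u w → E (ear D p q) w u
  ear-E-sym p zero          = pathSub-E-sym (pth D p 0)
  ear-E-sym p (suc zero)    = cycleSub-E-sym (cyc D p)
  ear-E-sym p (suc (suc q)) = pathSub-E-sym (pth D p (suc (suc q)))

  ear-E⇒V : ∀ p q {u w} → E (ear D p q) u w → V (ear D p q) w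
  ear-E⇒V p zero          = pathSub-E⇒V (pth D p 0)
  ear-E⇒V p (suc zero)    = cycleSub-E⇒V (cyc D p)
  ear-E⇒V p (suc (suc q)) = pathSub-E⇒V (pth D p (suc (suc q)))

  HH-E-sym : ∀ i j {u w} → E (HH D i j) u w → E (HH D i j) w u
  HH-E-sym i j (p , q , idx , e) = p , q , idx , ear-E-sym p q e

  HH-E⇒V : ∀ i j {u w} → E (HH D i j) u w → V (HH D i j) w
  HH-E⇒V i j (p , q , idx , e) = p , q , idx , ear-E⇒V p q e

  ear⊑HH : ∀ {i j p q} → InH D i j p q → ear D p q ⊑ HH D i j
  ear⊑HH {p = p} {q} idx = (λ v∈ → p , q , idx , v∈) , (λ e → p , q , idx , e)

  HH-mono : ∀ {i j i′ j′} → (∀ {p q} → InH D i j p q → InH D i′ j′ p q) → HH D i j ⊑ HH D i′ j′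
  HH-mono f = (λ (p , q , idx , v∈) → p , q , f idx , v∈) , (λ (p , q , idx , e) → p , q , f idx , e)

  InH-monoʳ : ∀ {i j j′ p q} → j ≤ j′ → InH D i j p q → InH D i j′ p q
  InH-monoʳ j≤ (1≤p , 1≤q , inj₁ earlier)      = 1≤p , 1≤q , inj₁ earlier
  InH-monoʳ j≤ (1≤p , 1≤q , inj₂ (p≡i , q≤j)) = 1≤p , 1≤q , inj₂ (p≡i , ≤-trans q≤j j≤)

  InH-prev : ∀ {i j p q} → 1 ≤ i → InH D (i ∸ 1) (ℓ D (i ∸ 1)) p q → InH D i j p q
  InH-prev {suc i} _ (1≤p , 1≤q , inj₁ (p<i , q≤))    = 1≤p , 1≤q , inj₁ (m<n⇒m<1+n p<i , q≤)
  InH-prev {suc i} _ (1≤p , 1≤q , inj₂ (refl , q≤)) = 1≤p , 1≤q , inj₁ (n<1+n i , q≤)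

  InH-earlier : ∀ {i p q} → 1 ≤ p → 1 ≤ q → p < i → q ≤ ℓ D p → InH D (i ∸ 1) (ℓ D (i ∸ 1)) p q
  InH-earlier {zero}  _   _   ()    _
  InH-earlier {suc i} 1≤p 1≤q p<1+i q≤ with m<1+n⇒m<n∨m≡n p<1+i
  ... | inj₁ p<i  = 1≤p , 1≤q , inj₁ (p<i , q≤)
  ... | inj₂ refl = 1≤p , 1≤q , inj₂ (refl , q≤)

  InH-zero⁻ : ∀ {i p q} → InH D i 0 p q → InH D (i ∸ 1) (ℓ D (i ∸ 1)) p q
  InH-zero⁻ (1≤p , 1≤q , inj₁ (p<1+i , q≤)) = InH-earlier 1≤p 1≤q p<1+i q≤
  InH-zero⁻ (_ , () , inj₂ (_ , z≤n))

  InH-suc⁻ : ∀ {i j p q} → InH D i (suc j) p q → InH D i j p q ⊎ (p ≡ i × q ≡ suc j)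
  InH-suc⁻ (1≤p , 1≤q , inj₁ earlier) = inj₁ (1≤p , 1≤q , inj₁ earlier)
  InH-suc⁻ (1≤p , 1≤q , inj₂ (p≡i , q≤1+j)) with m≤n⇒m<n∨m≡n q≤1+j
  ... | inj₁ q<1+j = inj₁ (1≤p , 1≤q , inj₂ (p≡i , s≤s⁻¹ q<1+j))
  ... | inj₂ q≡1+j = inj₂ (p≡i , q≡1+j)

  ∈-HH-suc⁻ : ∀ {i j v} → V (HH D i (suc j)) v → V (HH D i j) v ⊎ V (ear D i (suc j)) v
  ∈-HH-suc⁻ (p , q , idx , v∈) with InH-suc⁻ idx
  ... | inj₁ idx′         = inj₁ (p , q , idx′ , v∈)
  ... | inj₂ (refl , refl) = inj₂ v∈

  ∈-newest : ∀ {i j v} → V (HH D i (suc j)) v → ¬ V (HH D i j) v → V (ear D i (suc j)) v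
  ∈-newest v∈ v∉ = [ ⊥-elim ∘ v∉ , id ]′ (∈-HH-suc⁻ v∈)

  ∈-HH-zero⁻ : ∀ {i v} → V (HH D i 0) v → V (HH D (i ∸ 1) (ℓ D (i ∸ 1))) v
  ∈-HH-zero⁻ (p , q , idx , v∈) = p , q , InH-zero⁻ idx , v∈

  ∈-HH-one⁻ : ∀ {i v} → V (HH D i 1) v → V (HH D (i ∸ 1) (ℓ D (i ∸ 1))) v ⊎ V (cycleSub (cyc D i)) v
  ∈-HH-one⁻ = Sum.map₁ ∈-HH-zero⁻ ∘ ∈-HH-suc⁻

  1≤i-of-HH : ∀ {i j v} → V (HH D i j) v → 1 ≤ i
  1≤i-of-HH (_ , _ , (1≤p , _ , inj₁ (p<i , _)) , _) = ≤-trans 1≤p (<⇒≤ p<i)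
  1≤i-of-HH (_ , _ , (1≤p , _ , inj₂ (refl , _)) , _) = 1≤p

  InH? : ∀ i j p q → Dec (InH D i j p q)
  InH? i j p q = 1 ≤? p ×-dec 1 ≤? q ×-dec ((p <? i ×-dec q ≤? ℓ D p) ⊎-dec (p ≟ i ×-dec q ≤? j))

  ear-V? : ∀ p q v → Dec (V (ear D p q) v)
  ear-V? p zero          v = Fin.any? (λ k → vtx (pth D p 0) k Fin.≟ v)
  ear-V? p (suc zero)    v = Fin.any? (λ k → cv (cyc D p) k Fin.≟ v)
  ear-V? p (suc (suc q)) v = Fin.any? (λ k → vtx (pth D p (suc (suc q))) k Fin.≟ v)

  HH-V? : ∀ i j v → Dec (V (HH D i j) v)
  HH-V? i j v = map′ (λ (p , _ , q , _ , idx , v∈) → p , q , idx , v∈) bounded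
    (anyUpTo? (λ p → anyUpTo? (λ q → InH? i j p q ×-dec ear-V? p q v) (suc (ℓ D p + j))) (suc i))
    where
    bounded : V (HH D i j) v →
              ∃ λ p → p < suc i × ∃ λ q → q < suc (ℓ D p + j) × InH D i j p q × V (ear D p q) v
    bounded (p , q , idx@(_ , _ , inj₁ (p<i , q≤)) , v∈) =
      p , s≤s (<⇒≤ p<i) , q , s≤s (≤-trans q≤ (m≤m+n _ j)) , idx , v∈
    bounded (p , q , idx@(_ , _ , inj₂ (refl , q≤)) , v∈) =
      p , s≤s ≤-refl , q , s≤s (≤-trans q≤ (m≤n+m j _)) , idx , v∈


  newest-ear-TwoNeighbours : ∀ i j → suc i ≤ t D → suc j ≤ ℓ D (suc i) →
    (∀ {w} → V (HH D (suc i) j) w → TwoNeighbours (HH D (suc i) j) w) →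
    ∀ {v} → V (ear D (suc i) (suc j)) v → TwoNeighbours (HH D (suc i) (suc j)) v
  newest-ear-TwoNeighbours i zero _ _ _ v∈ =
    TwoNeighbours-mono (ear⊑HH (s≤s z≤n , s≤s z≤n , inj₂ (refl , ≤-refl)))
      (cycle-TwoNeighbours (cyc D (suc i)) v∈)
  newest-ear-TwoNeighbours i (suc j) i< j< earlier v∈
    with condC (suc i) (suc (suc j)) (s≤s z≤n) i< (s≤s (s≤s z≤n)) j<
  ... | _ , (_ , start∈ , end∈ , _) , _ =
    path-TwoNeighbours (pth D (suc i) (suc (suc j))) (HH-mono (InH-monoʳ (n≤1+n (suc j))))
      (ear⊑HH (s≤s z≤n , s≤s z≤n , inj₂ (refl , ≤-refl))) start∈ end∈ earlier v∈

  module _ (i : ℕ) (i< : suc i ≤ t D)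
           (previous : ∀ {v} → V (HH D i (ℓ D i)) v → TwoNeighbours (HH D i (ℓ D i)) v) where

    level-TwoNeighbours : ∀ j → j ≤ ℓ D (suc i) → ∀ {v} → V (HH D (suc i) j) v →
                          TwoNeighbours (HH D (suc i) j) v
    level-TwoNeighbours zero _ v∈ =
      TwoNeighbours-mono (HH-mono (InH-prev (s≤s z≤n))) (previous (∈-HH-zero⁻ v∈))
    level-TwoNeighbours (suc j) j< v∈ with ∈-HH-suc⁻ v∈
    ... | inj₁ v∈′ =
      TwoNeighbours-mono (HH-mono (InH-monoʳ (n≤1+n j))) (level-TwoNeighbours j (<⇒≤ j<) v∈′)
    ... | inj₂ v∈′ = newest-ear-TwoNeighbours i j i< j< (level-TwoNeighbours j (<⇒≤ j<)) v∈′

  HH-TwoNeighbours : ∀ i j → i ≤ t D → j ≤ ℓ D i → ∀ {v} → V (HH D i j) v → TwoNeighbours (HH D i j) v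
  HH-TwoNeighbours zero    j _  _ v∈ = ⊥-elim (<⇒≱ (1≤i-of-HH v∈) z≤n)
  HH-TwoNeighbours (suc i) j i< =
    level-TwoNeighbours i i< (HH-TwoNeighbours i (ℓ D i) (<⇒≤ i<) ≤-refl) j

module ShortHPath (G : Graph) (girth : Girth≥5 G) (D : EarData G) (dc : IsCoarseEarDecomp D) where
  open NPaths G
  open Subgraphs G
  open EarDecomposition G D dc
  open IsCoarseEarDecomp dc

  T : ℕ
  T = t D

  Hₜ Hₚ : Sub G
  Hₜ = HH D T (ℓ D T)
  Hₚ = HH D (T ∸ 1) (ℓ D (T ∸ 1))

  Zₚ : Vertex → Set
  Zₚ = Z Hₚ

  C : Cycle G
  C = cyc D T

  Hₚ⊑Hₜ : Hₚ ⊑ Hₜ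
  Hₚ⊑Hₜ = HH-mono (InH-prev t≥1)

  C⊑Hₜ : cycleSub C ⊑ Hₜ
  C⊑Hₜ = ear⊑HH (t≥1 , s≤s z≤n , inj₂ (refl , ℓ≥1 T t≥1 ≤-refl))

  Hₜ-E-sym : ∀ {u w} → E Hₜ u w → E Hₜ w u
  Hₜ-E-sym = HH-E-sym T (ℓ D T)

  Shortens : Sub G → NPath → Set
  Shortens H P = ∃ λ R → HPath H (Z H) R × size R < size P

  record Shortcut (y x : Vertex) (R : NPath) : Set where
    field
      hpath  : HPath Hₜ (Z Hₜ) R
      first≡ : first R ≡ y
      last≡  : last R ≡ x
      size≤2 : size R ≤ 2
  open Shortcut public

  Shortcut-reverse : ∀ {y x R} → Shortcut y x R → Shortcut x y (reverse R)
  Shortcut-reverse {R = R} s = record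
    { hpath  = HPath-reverse Hₜ-E-sym (hpath s)
    ; first≡ = last≡ s
    ; last≡  = trans (reverse-last R) (first≡ s)
    ; size≤2 = size≤2 s }

  module _ {y x R} (s : Shortcut y x R) where

    y∈R : y ∈ᴾ R
    y∈R = subst (_∈ᴾ R) (first≡ s) (first-∈ R)

    x∈R : x ∈ᴾ R
    x∈R = subst (_∈ᴾ R) (last≡ s) (last-∈ R)

    shortcut-ends-differ : y ≢ x
    shortcut-ends-differ y≡x =
      first≢last R (nontrivial (hpath s)) (trans (first≡ s) (trans y≡x (sym (last≡ s))))

    y∉Y : ¬ Y Hₜ y
    y∉Y = avoids (hpath s) y∈R ∘ Y⊆Z

    x∉Y : ¬ Y Hₜ x
    x∉Y = avoids (hpath s) x∈R ∘ Y⊆Z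

    shortcut-classify : ∀ {v} → v ∈ᴾ R → v ≡ y ⊎ v ≡ x ⊎ (¬ V Hₜ v × ¬ Z Hₜ v)
    shortcut-classify {v} v∈ with v Fin.≟ y | v Fin.≟ x
    ... | yes v≡y | _       = inj₁ v≡y
    ... | no  _   | yes v≡x = inj₂ (inj₁ v≡x)
    ... | no  v≢y | no  v≢x = inj₂ (inj₂ (inner∉H (hpath s) v∈ (v≢y ∘ flip trans (first≡ s))
                                                          (v≢x ∘ flip trans (last≡ s))
                                          , avoids (hpath s) v∈))

    shortcut-meets : ∀ {v A} → Within Hₜ A → v ∈ᴾ A → v ∈ᴾ R → v ≡ y ⊎ v ≡ x
    shortcut-meets A⊆Hₜ v∈A v∈R with shortcut-classify v∈R
    ... | inj₁ v≡y               = inj₁ v≡y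
    ... | inj₂ (inj₁ v≡x)        = inj₂ v≡x
    ... | inj₂ (inj₂ (v∉Hₜ , _)) = ⊥-elim (v∉Hₜ (vertices-in A⊆Hₜ v∈A))

    module _ {H : Sub G} (H⊑Hₜ : H ⊑ Hₜ) where

      shortcut-inner : Inner∉ H R
      shortcut-inner v∈ v≢first v≢last = inner∉H (hpath s) v∈ v≢first v≢last ∘ proj₁ H⊑Hₜ

      shortcut-steps : Steps∉ H R
      shortcut-steps st = steps∉H (hpath s) st ∘ proj₂ H⊑Hₜ

      shortcut-avoids : ¬ Z H y → ¬ Z H x → Avoids (Z H) R
      shortcut-avoids y∉ x∉ = HPath-avoids-shrink H⊑Hₜ (hpath s)
        (subst (¬_ ∘ Z H) (sym (first≡ s)) y∉) (subst (¬_ ∘ Z H) (sym (last≡ s)) x∉)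

  module ShortcutCycle {y x R} (s : Shortcut y x R) (A : NPath) (A-first : first A ≡ x) (A-last : last A ≡ y)
                       (1≤A : 1 ≤ size A) (A⊆Hₜ : Within Hₜ A) where

    private
      shares : ∀ {v} → v ∈ᴾ A → v ∈ᴾ R → v ≡ first A ⊎ v ≡ last A
      shares v∈A v∈R =
        Sum.swap (Sum.map (flip trans (sym A-last)) (flip trans (sym A-first)) (shortcut-meets s A⊆Hₜ v∈A v∈R))

    open Closing A R (trans A-last (sym (first≡ s))) (trans (last≡ s) (sym A-first)) shares 1≤A
      (nontrivial (hpath s)) (λ stA stR → steps∉H (hpath s) stR (Hₜ-E-sym (steps-in A⊆Hₜ stA))) public

    shortcut-shorter : size R < size A
    shortcut-shorter = 5≤m+n⇒n<m (size≤2 s) (subst (5 ≤_) cycle-clen (girth cycle))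

  module Rerouting {H : Sub G} (H⊑Hₜ : H ⊑ Hₜ) {P : NPath} (h : HPath H (Z H) P) (P⊆Hₜ : Within Hₜ P)
    where

    private
      segment-to-last : ∀ {a} (a≤ : a ≤ size P) → vertex P (a + (size P ∸ a)) ≡ last P
      segment-to-last a≤ = cong (vertex P) (m+[n∸m]≡n a≤)

    -- As x ∉ Y Hₜ, x is at distance at least 3 along P from the branch vertex first P, more than the
    -- length of the shortcut.
    reroute : ∀ {a x y R} → V≥3 Hₜ (first P) → a ≤ size P → vertex P a ≡ x → ¬ V H x → V H y → y ≢ last P →
              Shortcut y x R → Shortens H P
    reroute {a} {x} {y} {R} first≥3 a≤ x≡ x∉H y∈H y≢last s = R′ , hR′ , shorter
      where
      3≤a : 3 ≤ a
      3≤a with a ≤? 2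
      ... | yes a≤2 = ⊥-elim (x∉Y s (subst (Y Hₜ) x≡ (Reach-weaken a≤2 (Reach-along P⊆Hₜ first≥3 a a≤))))
      ... | no  a≰2 = ≰⇒> a≰2

      S≤ : a + (size P ∸ a) ≤ size P
      S≤ = ≤-reflexive (m+[n∸m]≡n a≤)

      S : NPath
      S = segment P a (size P ∸ a) S≤

      glue : last R ≡ first S
      glue = trans (last≡ s) (sym (trans (segment-first P a (size P ∸ a) S≤) x≡))

      shares : SharesOnlyLast R S
      shares v∈R v∈S with shortcut-meets s (Within-segment a (size P ∸ a) S≤ P⊆Hₜ) v∈S v∈R
      ... | inj₂ v≡x  = trans v≡x (sym (last≡ s))
      ... | inj₁ refl = ⊥-elim (Inner∉-segment {H} P a (size P ∸ a) S≤ (inner∉H h) v∈S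
          (shortcut-ends-differ s ∘ flip trans (trans (segment-first P a (size P ∸ a) S≤) x≡))
          (y≢last ∘ flip trans (segment-to-last a≤)) y∈H)

      R′ : NPath
      R′ = join R S glue shares

      hR′ : HPath H (Z H) R′
      hR′ = record
        { nontrivial = ≤-trans (nontrivial (hpath s)) (m≤m+n _ _)
        ; first∈H    = subst (V H) (sym (trans (join-first R S glue shares) (first≡ s))) y∈H
        ; last∈H     = subst (V H) (sym (trans (join-last R S glue shares) (segment-to-last a≤))) (last∈H h)
        ; inner∉H    = Inner∉-join {H} R S glue shares (shortcut-inner s H⊑Hₜ)
                         (Inner∉-segment {H} P a (size P ∸ a) S≤ (inner∉H h)) (subst (¬_ ∘ V H) (sym (last≡ s)) x∉H)
        ; steps∉H    = Steps∉-join {H} R S glue shares (shortcut-steps s H⊑Hₜ)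
                         (steps∉H h ∘ Step-segment⁻ P a (size P ∸ a) S≤)
        ; avoids     = Avoids-join {Z H} R S glue shares
                         (shortcut-avoids s H⊑Hₜ (∉Z-shrink H⊑Hₜ y∈H (avoids (hpath s) (y∈R s)))
                                                 (avoids h (a , a≤ , x≡)))
                         (avoids h ∘ ∈-segment⇒∈ P a (size P ∸ a) S≤) }

      shorter : size R + (size P ∸ a) < size P
      shorter = subst (size R + (size P ∸ a) <_) (m+[n∸m]≡n a≤)
                  (+-monoˡ-< (size P ∸ a) (≤-<-trans (size≤2 s) 3≤a))

    -- By girth, the shortcut is shorter than the part of P between its ends.
    splice : ∀ {a b x y R} → a < b → b ≤ size P → vertex P a ≡ x → vertex P b ≡ y → ¬ V H x → ¬ V H y →
             Shortcut x y R → Shortens H P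
    splice {a} {b} {x} {y} {R} a<b b≤ x≡ y≡ x∉H y∉H s = R′ , hR′ , shorter
      where
      a≤b : a ≤ b
      a≤b = <⇒≤ a<b

      M≤ : a + (b ∸ a) ≤ size P
      M≤ = ≤-trans (≤-reflexive (m+[n∸m]≡n a≤b)) b≤

      R<b∸a : size R < b ∸ a
      R<b∸a = ShortcutCycle.shortcut-shorter (Shortcut-reverse s) (segment P a (b ∸ a) M≤)
        (trans (segment-first P a _ M≤) x≡) (trans (cong (vertex P) (m+[n∸m]≡n a≤b)) y≡)
        (m<n⇒0<n∸m a<b) (Within-segment a (b ∸ a) M≤ P⊆Hₜ)

      S₁≤ : 0 + a ≤ size P
      S₁≤ = ≤-trans a≤b b≤

      S₂≤ : b + (size P ∸ b) ≤ size P
      S₂≤ = ≤-reflexive (m+[n∸m]≡n b≤)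

      S₁ S₂ : NPath
      S₁ = segment P 0 a S₁≤
      S₂ = segment P b (size P ∸ b) S₂≤

      y∉S₁ : ¬ y ∈ᴾ S₁
      y∉S₁ y∈ = <⇒≱ a<b (proj₂ (∈-segment-index P 0 a S₁≤ b≤ (subst (_∈ᴾ S₁) (sym y≡) y∈)))

      S₁∩S₂ : ∀ {v} → v ∈ᴾ S₁ → ¬ v ∈ᴾ S₂
      S₁∩S₂ v∈S₁ v∈S₂ with ∈-segment⁻ P 0 a S₁≤ v∈S₁
      ... | k , _ , k≤a , refl =
        <⇒≱ a<b (≤-trans (proj₁ (∈-segment-index P b _ S₂≤ (≤-trans k≤a S₁≤) v∈S₂)) k≤a)

      glue₁ : last S₁ ≡ first R
      glue₁ = trans x≡ (sym (first≡ s))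

      shares₁ : SharesOnlyLast S₁ R
      shares₁ v∈S₁ v∈R with shortcut-meets s (Within-segment 0 a S₁≤ P⊆Hₜ) v∈S₁ v∈R
      ... | inj₁ v≡x  = trans v≡x (sym x≡)
      ... | inj₂ refl = ⊥-elim (y∉S₁ v∈S₁)

      X : NPath
      X = join S₁ R glue₁ shares₁

      X-last : last X ≡ y
      X-last = trans (join-last S₁ R glue₁ shares₁) (last≡ s)

      glue₂ : last X ≡ first S₂
      glue₂ = trans X-last (sym (trans (segment-first P b _ S₂≤) y≡))

      shares₂ : SharesOnlyLast X S₂
      shares₂ v∈X v∈S₂ with ∈-join⁻ S₁ R glue₁ shares₁ v∈X
      ... | inj₁ v∈S₁ = ⊥-elim (S₁∩S₂ v∈S₁ v∈S₂)
      ... | inj₂ v∈R with shortcut-meets s (Within-segment b _ S₂≤ P⊆Hₜ) v∈S₂ v∈R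
      ...   | inj₂ v≡y  = trans v≡y (sym X-last)
      ...   | inj₁ refl = ⊥-elim (S₁∩S₂ (subst (_∈ᴾ S₁) x≡ (last-∈ S₁)) v∈S₂)

      R′ : NPath
      R′ = join X S₂ glue₂ shares₂

      hR′ : HPath H (Z H) R′
      hR′ = record
        { nontrivial = ≤-trans (nontrivial (hpath s)) (≤-trans (m≤n+m _ a) (m≤m+n _ _))
        ; first∈H    = subst (V H) (sym (trans (join-first X S₂ glue₂ shares₂)
                                                (join-first S₁ R glue₁ shares₁))) (first∈H h)
        ; last∈H     = subst (V H) (sym (trans (join-last X S₂ glue₂ shares₂)
                                                (cong (vertex P) (m+[n∸m]≡n b≤)))) (last∈H h)
        ; inner∉H    = Inner∉-join {H} X S₂ glue₂ shares₂
            (Inner∉-join {H} S₁ R glue₁ shares₁ (Inner∉-segment {H} P 0 a S₁≤ (inner∉H h))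
               (shortcut-inner s H⊑Hₜ) (subst (¬_ ∘ V H) (sym x≡) x∉H))
            (Inner∉-segment {H} P b _ S₂≤ (inner∉H h)) (subst (¬_ ∘ V H) (sym X-last) y∉H)
        ; steps∉H    = Steps∉-join {H} X S₂ glue₂ shares₂
            (Steps∉-join {H} S₁ R glue₁ shares₁ (steps∉H h ∘ Step-segment⁻ P 0 a S₁≤)
               (shortcut-steps s H⊑Hₜ))
            (steps∉H h ∘ Step-segment⁻ P b _ S₂≤)
        ; avoids     = Avoids-join X S₂ glue₂ shares₂
            (Avoids-join S₁ R glue₁ shares₁ (avoids h ∘ ∈-segment⇒∈ P 0 a S₁≤)
               (shortcut-avoids s H⊑Hₜ (avoids h (a , ≤-trans a≤b b≤ , x≡)) (avoids h (b , b≤ , y≡))))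
            (avoids h ∘ ∈-segment⇒∈ P b _ S₂≤) }

      shorter : a + size R + (size P ∸ b) < size P
      shorter = subst (a + size R + (size P ∸ b) <_) (m+[n∸m]≡n b≤)
        (+-monoˡ-< (size P ∸ b) (subst (a + size R <_) (m+[n∸m]≡n a≤b) (+-monoʳ-< a R<b∸a)))

  module PathEar (j : ℕ) (j≤ : suc (suc j) ≤ ℓ D T) where

    private
      P : Path G
      P = pth D T (suc (suc j))

      P⁰ : NPath
      P⁰ = fromPath P

      H : Sub G
      H = HH D T (suc j)

      condition : PathAvoids (Z H) P × IsHPath H P ×
                  (∀ Q → PathAvoids (Z H) Q → IsHPath H Q → len P ≤ len Q)
      condition = condC T (suc (suc j)) t≥1 ≤-refl (s≤s (s≤s z≤n)) j≤

      h : HPath H (Z H) P⁰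
      h = IsHPath⇒HPath P (proj₁ condition) (proj₁ (proj₂ condition))

      minimal : ¬ Shortens H P⁰
      minimal (R , hR , R<P) = <⇒≱ R<P (uncurry (proj₂ (proj₂ condition) (toPath R)) (HPath⇒IsHPath hR))

      H⊑Hₜ : H ⊑ Hₜ
      H⊑Hₜ = HH-mono (InH-monoʳ (≤-trans (n≤1+n _) j≤))

      P⊆Hₜ : Within Hₜ P⁰
      P⊆Hₜ = Within-mono (ear⊑HH (t≥1 , s≤s z≤n , inj₂ (refl , j≤))) (Within-fromPath P)

      first≥3 : ∀ {R} → HPath H (Z H) R → Within Hₜ R → V≥3 Hₜ (first R)
      first≥3 hR R⊆Hₜ = HPath-first-V≥3 H⊑Hₜ hR
        (HH-TwoNeighbours T (suc j) ≤-refl (≤-trans (n≤1+n _) j≤) (first∈H hR)) (steps-in R⊆Hₜ)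

      reroute-from-either-end : ∀ {a x y R} → a ≤ size P⁰ → vertex P⁰ a ≡ x → ¬ V H x → V H y →
                                Shortcut y x R → Shortens H P⁰
      reroute-from-either-end {a} {y = y} a≤ x≡ x∉H y∈H s with y Fin.≟ last P⁰
      ... | no  y≢last = Rerouting.reroute H⊑Hₜ h P⊆Hₜ (first≥3 h P⊆Hₜ) a≤ x≡ x∉H y∈H y≢last s
      ... | yes y≡last = Rerouting.reroute H⊑Hₜ hʳ Pʳ⊆Hₜ (first≥3 hʳ Pʳ⊆Hₜ) (m∸n≤m _ a)
          (trans (cong (vertex P⁰) (m∸[m∸n]≡n a≤)) x≡) x∉H y∈H
          (λ y≡first → first≢last P⁰ (nontrivial h) (trans (sym (trans y≡first (reverse-last P⁰))) y≡last))
          s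
        where
        hʳ : HPath H (Z H) (reverse P⁰)
        hʳ = HPath-reverse (HH-E-sym T (suc j)) h
        Pʳ⊆Hₜ : Within Hₜ (reverse P⁰)
        Pʳ⊆Hₜ = Within-reverse Hₜ-E-sym P⊆Hₜ

    no-shortcut-into-path-ear : ∀ {x y R} → V (pathSub P) x → ¬ V H x → V (HH D T (suc (suc j))) y →
                                ¬ Shortcut y x R
    no-shortcut-into-path-ear {y = y} x∈P x∉H y∈ s with ∈-fromPath⁺ P x∈P | HH-V? T (suc j) y
    ... | a , a≤ , x≡ | yes y∈H = minimal (reroute-from-either-end a≤ x≡ x∉H y∈H s)
    ... | a , a≤ , x≡ | no  y∉H with ∈-fromPath⁺ P (∈-newest y∈ y∉H)
    ...   | b , b≤ , y≡ with <-cmp a b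
    ...     | tri< a<b _ _  =
      minimal (Rerouting.splice H⊑Hₜ h P⊆Hₜ a<b b≤ x≡ y≡ x∉H y∉H (Shortcut-reverse s))
    ...     | tri≈ _ refl _ = shortcut-ends-differ s (trans (sym y≡) x≡)
    ...     | tri> _ _ b<a  = minimal (Rerouting.splice H⊑Hₜ h P⊆Hₜ b<a a≤ y≡ x≡ y∉H x∉H s)

  module CycleEar {x y R} (x∈C : V (cycleSub C) x) (x∉Hₚ : ¬ V Hₚ x) (s : Shortcut y x R) where

    private
      x≢y : x ≢ y
      x≢y = shortcut-ends-differ s ∘ sym

      shortcut-cycle-avoids : ∀ {A} (A-first : first A ≡ x) (A-last : last A ≡ y) (1≤A : 1 ≤ size A)
        (A⊆C : Within (cycleSub C) A) → CycleAvoids Zₚ C → V (cycleSub C) y →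
        CycleAvoids Zₚ (ShortcutCycle.cycle s A A-first A-last 1≤A (Within-mono C⊑Hₜ A⊆C))
      shortcut-cycle-avoids {A} A-first A-last 1≤A A⊆C C-avoids y∈C k =
        [ C∉Zₚ ∘ vertices-in A⊆C , shortcut-avoids s Hₚ⊑Hₜ (C∉Zₚ y∈C) (C∉Zₚ x∈C) ]′
        (ShortcutCycle.∈-cycle⁻ s A A-first A-last 1≤A (Within-mono C⊑Hₜ A⊆C) (k , refl))
        where
        C∉Zₚ : ∀ {w} → V (cycleSub C) w → ¬ Zₚ w
        C∉Zₚ = CycleAvoids-∉ {Zₚ} {C} C-avoids

    -- One arc of C and the shortcut form a cycle avoiding Zₚ, shorter than C because by girth
    -- the shortcut is shorter than the other arc.
    type2-cycle-misses-end : CycleAvoids Zₚ C → (∀ C′ → CycleAvoids Zₚ C′ → clen C ≤ clen C′) →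
                             ¬ V (cycleSub C) y
    type2-cycle-misses-end C-avoids C-minimal y∈C =
      <⇒≱ shorter
        (C-minimal C₁.cycle (shortcut-cycle-avoids arc₁-first arc₁-last 1≤arc₁ arc₁-within C-avoids y∈C))
      where
      open Arcs (arcs C x∈C y∈C x≢y)
      1≤arc₁ : 1 ≤ size arc₁
      1≤arc₁ = 1≤size arc₁ arc₁-first arc₁-last x≢y
      module C₁ = ShortcutCycle s arc₁ arc₁-first arc₁-last 1≤arc₁ (Within-mono C⊑Hₜ arc₁-within)
      module C₂ = ShortcutCycle s arc₂ arc₂-first arc₂-last (1≤size arc₂ arc₂-first arc₂-last x≢y)
                    (Within-mono C⊑Hₜ arc₂-within)
      shorter : clen C₁.cycle < clen C
      shorter = subst₂ _<_ (sym C₁.cycle-clen) arcs-size (+-monoʳ-< (size arc₁) C₂.shortcut-shorter)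

    module Type1 {v} (v∈C : V (cycleSub C) v) (v∈Hₚ : V Hₚ v)
                 (unique : ∀ w → V (cycleSub C) w → V Hₚ w → w ≡ v) (C-avoids : CycleAvoids Zₚ C) where

      private
        x≢v : x ≢ v
        x≢v refl = x∉Hₚ v∈Hₚ

        C∉Zₚ : ∀ {w} → V (cycleSub C) w → ¬ Zₚ w
        C∉Zₚ = CycleAvoids-∉ {Zₚ} {C} C-avoids

        C∖v∉Hₚ : ∀ {w} → V (cycleSub C) w → w ≢ v → ¬ V Hₚ w
        C∖v∉Hₚ w∈C w≢v = w≢v ∘ unique _ w∈C

        C-steps∉Hₚ : ∀ {A} → Within (cycleSub C) A → Steps∉ Hₚ A
        C-steps∉Hₚ {A} A⊆C {u} st e = Step⇒≢ {A} st (trans (unique _ u∈C (HH-E⇒V _ _ (HH-E-sym _ _ e)))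
                                               (sym (unique _ (cycleSub-E⇒V C (steps-in A⊆C st)) (HH-E⇒V _ _ e))))
          where
          u∈C : V (cycleSub C) u
          u∈C = cycleSub-E⇒V C (cycleSub-E-sym C (steps-in A⊆C st))

        x→v : Arcs C x v
        x→v = arcs C x∈C v∈C x≢v

        v-branch : V≥3 Hₜ v
        v-branch = V≥3-extend Hₚ⊑Hₜ v∈Hₚ (HH-TwoNeighbours (T ∸ 1) _ (m∸n≤m T 1) ≤-refl v∈Hₚ)
          (proj₂ C⊑Hₜ (cycleSub-E-sym C last-edge)) (C-steps∉Hₚ arc₁-within last-step′ ∘ HH-E-sym _ _)
          where
          open Arcs x→v
          last-step′ : Step arc₁ (vertex arc₁ (size arc₁ ∸ 1)) v
          last-step′ = subst (Step arc₁ _) arc₁-last (last-step arc₁ (1≤size arc₁ arc₁-first arc₁-last x≢v))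
          last-edge : E (cycleSub C) (vertex arc₁ (size arc₁ ∸ 1)) v
          last-edge = steps-in arc₁-within last-step′

      -- Otherwise the shortcut followed by the arc of C from x to v would be an Hₚ-path avoiding Zₚ;
      -- y ≠ v because v is a branch vertex of Hₜ.
      type1-misses-Hₚ-end : ¬ V Hₚ y
      type1-misses-Hₚ-end y∈Hₚ = condA T t≥1 ≤-refl (toPath R′ , HPath⇒IsHPath hR′)
        where
        open Arcs x→v
        y≢v : y ≢ v
        y≢v refl = y∉Y s (here v-branch (proj₁ v-branch))

        glue : last R ≡ first arc₁
        glue = trans (last≡ s) (sym arc₁-first)

        shares : SharesOnlyLast R arc₁
        shares w∈R w∈arc with shortcut-meets s (Within-mono C⊑Hₜ arc₁-within) w∈arc w∈R
        ... | inj₂ w≡x  = trans w≡x (sym (last≡ s))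
        ... | inj₁ refl = ⊥-elim (y≢v (unique _ (vertices-in arc₁-within w∈arc) y∈Hₚ))

        R′ : NPath
        R′ = join R arc₁ glue shares

        hR′ : HPath Hₚ Zₚ R′
        hR′ = record
          { nontrivial = ≤-trans (nontrivial (hpath s)) (m≤m+n _ _)
          ; first∈H    = subst (V Hₚ) (sym (trans (join-first R arc₁ glue shares) (first≡ s))) y∈Hₚ
          ; last∈H     = subst (V Hₚ) (sym (trans (join-last R arc₁ glue shares) arc₁-last)) v∈Hₚ
          ; inner∉H    = Inner∉-join {Hₚ} R arc₁ glue shares (shortcut-inner s Hₚ⊑Hₜ)
              (λ w∈ _ w≢last → C∖v∉Hₚ (vertices-in arc₁-within w∈) (w≢last ∘ flip trans (sym arc₁-last)))
              (subst (¬_ ∘ V Hₚ) (sym (last≡ s)) x∉Hₚ)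
          ; steps∉H    = Steps∉-join {Hₚ} R arc₁ glue shares (shortcut-steps s Hₚ⊑Hₜ)
                           (C-steps∉Hₚ arc₁-within)
          ; avoids     = Avoids-join R arc₁ glue shares
              (shortcut-avoids s Hₚ⊑Hₜ (∉Z-shrink Hₚ⊑Hₜ y∈Hₚ (avoids (hpath s) (y∈R s))) (C∉Zₚ x∈C))
              (C∉Zₚ ∘ vertices-in arc₁-within) }

      -- Going from x round C through v to y, and back along the shortcut, gives a cycle meeting Hₚ only
      -- in v which is shorter than C, since by girth the shortcut is shorter than the arc from x to y
      -- that it replaces.
      module Detour (minimal : ∀ C′ → CycleAvoids Zₚ C′ → MeetsOnce Hₚ C′ → clen C ≤ clen C′)
                    (y∈C : V (cycleSub C) y) (y∉Hₚ : ¬ V Hₚ y)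
                    (ar : Arcs C x v) {k} (k≤ : k ≤ size (Arcs.arc₁ ar)) (y≡ : vertex (Arcs.arc₁ ar) k ≡ y)
        where
        open Arcs ar

        private
          1≤k : 1 ≤ k
          1≤k = n≢0⇒n>0 (λ { refl → x≢y (trans (sym arc₁-first) y≡) })

          R<k : size R < k
          R<k = ShortcutCycle.shortcut-shorter s (segment arc₁ 0 k k≤) arc₁-first y≡ 1≤k
                  (Within-mono C⊑Hₜ (Within-segment 0 k k≤ arc₁-within))

          B≤ : k + (size arc₁ ∸ k) ≤ size arc₁
          B≤ = ≤-reflexive (m+[n∸m]≡n k≤)

          B : NPath
          B = segment arc₁ k (size arc₁ ∸ k) B≤

          glue : last arc₂ ≡ first (reverse B)
          glue = trans arc₂-last (sym (trans (cong (vertex arc₁) (m+[n∸m]≡n k≤)) arc₁-last))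

          shares : SharesOnlyLast arc₂ (reverse B)
          shares w∈arc₂ w∈B with ∈-segment⁻ arc₁ k _ B≤ (∈-reverse⁻ B w∈B)
          ... | i , k≤i , i≤ , refl with arcs-meet (i , ≤-trans i≤ B≤ , refl) w∈arc₂
          ...   | inj₂ w≡v = trans w≡v (sym arc₂-last)
          ...   | inj₁ w≡x = ⊥-elim (<⇒≱ 1≤k (≤-trans k≤i (≤-reflexive
                    (vertex-injective arc₁ (≤-trans i≤ B≤) z≤n (trans w≡x (sym arc₁-first))))))

          A : NPath
          A = join arc₂ (reverse B) glue shares

          A-first : first A ≡ x
          A-first = trans (join-first arc₂ (reverse B) glue shares) arc₂-first

          A-last : last A ≡ y
          A-last = trans (join-last arc₂ (reverse B) glue shares)
                     (trans (reverse-last B) (trans (segment-first arc₁ k _ B≤) y≡))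

          A⊆C : Within (cycleSub C) A
          A⊆C = Within-join arc₂-within (Within-reverse (cycleSub-E-sym C) (Within-segment k _ B≤ arc₁-within))

          1≤A : 1 ≤ size A
          1≤A = 1≤size A A-first A-last x≢y

          module C′ = ShortcutCycle s A A-first A-last 1≤A (Within-mono C⊑Hₜ A⊆C)

          shorter : clen C′.cycle < clen C
          shorter = begin-strict
            clen C′.cycle                               ≡⟨ C′.cycle-clen ⟩
            size arc₂ + (size arc₁ ∸ k) + size R        <⟨ +-monoʳ-< _ R<k ⟩
            size arc₂ + (size arc₁ ∸ k) + k             ≡⟨ +-assoc (size arc₂) _ k ⟩
            size arc₂ + (size arc₁ ∸ k + k)             ≡⟨ cong (size arc₂ +_) (m∸n+n≡m k≤) ⟩
            size arc₂ + size arc₁                       ≡⟨ +-comm (size arc₂) _ ⟩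
            size arc₁ + size arc₂                       ≡⟨ arcs-size ⟩
            clen C                                      ∎
            where open ≤-Reasoning

          meets-once : MeetsOnce Hₚ C′.cycle
          meets-once =
            v , C′.∈-cycle⁺ˡ (∈-join⁺ˡ arc₂ (reverse B) glue shares (subst (_∈ᴾ arc₂) arc₂-last (last-∈ arc₂))) ,
            v∈Hₚ , only-v
            where
            only-v : ∀ w → V (cycleSub C′.cycle) w → V Hₚ w → w ≡ v
            only-v w w∈ w∈Hₚ with C′.∈-cycle⁻ w∈
            ... | inj₁ w∈A = unique w (vertices-in A⊆C w∈A) w∈Hₚ
            ... | inj₂ w∈R with shortcut-classify s w∈R
            ...   | inj₁ refl              = ⊥-elim (y∉Hₚ w∈Hₚ)
            ...   | inj₂ (inj₁ refl)       = ⊥-elim (x∉Hₚ w∈Hₚ)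
            ...   | inj₂ (inj₂ (w∉Hₜ , _)) = ⊥-elim (w∉Hₜ (proj₁ Hₚ⊑Hₜ w∈Hₚ))

        impossible : ⊥
        impossible =
          <⇒≱ shorter (minimal C′.cycle (shortcut-cycle-avoids A-first A-last 1≤A A⊆C C-avoids y∈C) meets-once)

      type1-misses-C-end : (∀ C′ → CycleAvoids Zₚ C′ → MeetsOnce Hₚ C′ → clen C ≤ clen C′) →
                           V (cycleSub C) y → ¬ V Hₚ y → ⊥
      type1-misses-C-end minimal y∈C y∉Hₚ with Arcs.arcs-cover x→v y∈C
      ... | inj₁ (k , k≤ , y≡) = Detour.impossible minimal y∈C y∉Hₚ x→v k≤ y≡
      ... | inj₂ (k , k≤ , y≡) = Detour.impossible minimal y∈C y∉Hₚ (arcs-swap x→v) k≤ y≡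

    private
      y∈C : V (HH D T 1) y → ¬ V Hₚ y → V (cycleSub C) y
      y∈C y∈ y∉Hₚ = [ ⊥-elim ∘ y∉Hₚ , id ]′ (∈-HH-one⁻ y∈)

    not-type1 : V (HH D T 1) y → ¬ Type1Avail D T
    not-type1 y∈ available with condB1 T t≥1 ≤-refl available | HH-V? (T ∸ 1) (ℓ D (T ∸ 1)) y
    ... | C-avoids , (v , v∈C , v∈Hₚ , unique) , _       | yes y∈Hₚ =
      Type1.type1-misses-Hₚ-end v∈C v∈Hₚ unique C-avoids y∈Hₚ
    ... | C-avoids , (v , v∈C , v∈Hₚ , unique) , minimal | no  y∉Hₚ =
      Type1.type1-misses-C-end v∈C v∈Hₚ unique C-avoids minimal (y∈C y∈ y∉Hₚ) y∉Hₚ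

    other-end∈Hₚ : V (HH D T 1) y → V Hₚ y
    other-end∈Hₚ y∈ with HH-V? (T ∸ 1) (ℓ D (T ∸ 1)) y
    ... | yes y∈Hₚ = y∈Hₚ
    ... | no  y∉Hₚ =
      ⊥-elim (uncurry type2-cycle-misses-end (condB2 T t≥1 ≤-refl (not-type1 y∈)) (y∈C y∈ y∉Hₚ))

  2≤T : ∀ {v} → V Hₚ v → 2 ≤ T
  2≤T v∈ = subst (2 ≤_) (m∸n+n≡m t≥1) (+-monoˡ-≤ 1 (1≤i-of-HH v∈))

  module _ {u w R} (s : Shortcut u w R) where

    ends-in-previous-level : ∀ j → suc (suc j) ≤ ℓ D T →
                             V (HH D T (suc (suc j))) u → V (HH D T (suc (suc j))) w →
                             V (HH D T (suc j)) u × V (HH D T (suc j)) w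
    ends-in-previous-level j j≤ u∈ w∈ with HH-V? T (suc j) u | HH-V? T (suc j) w
    ... | yes u∈′ | yes w∈′ = u∈′ , w∈′
    ... | no  u∉  | _       =
      ⊥-elim (PathEar.no-shortcut-into-path-ear j j≤ (∈-newest u∈ u∉) u∉ w∈ (Shortcut-reverse s))
    ... | yes _   | no  w∉  =
      ⊥-elim (PathEar.no-shortcut-into-path-ear j j≤ (∈-newest w∈ w∉) w∉ u∈ s)

    ends-in-first-cycle : ∀ j → 1 ≤ j → j ≤ ℓ D T → V (HH D T j) u → V (HH D T j) w →
                          V (HH D T 1) u × V (HH D T 1) w
    ends-in-first-cycle (suc zero)    _ _  u∈ w∈ = u∈ , w∈
    ends-in-first-cycle (suc (suc j)) _ j≤ u∈ w∈ =
      uncurry (ends-in-first-cycle (suc j) (s≤s z≤n) (<⇒≤ j≤)) (ends-in-previous-level j j≤ u∈ w∈)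

    private
      u∈Hₜ : V Hₜ u
      u∈Hₜ = subst (V Hₜ) (first≡ s) (first∈H (hpath s))

      w∈Hₜ : V Hₜ w
      w∈Hₜ = subst (V Hₜ) (last≡ s) (last∈H (hpath s))

      not-both-in-Hₚ : V Hₚ u → ¬ V Hₚ w
      not-both-in-Hₚ u∈Hₚ w∈Hₚ = condA T t≥1 ≤-refl (toPath R , HPath⇒IsHPath
        (HPath-shrink Hₚ⊑Hₜ (hpath s) (subst (V Hₚ) (sym (first≡ s)) u∈Hₚ) (subst (V Hₚ) (sym (last≡ s)) w∈Hₚ)))

    short-HPath-ends : 2 ≤ T × ((V Hₚ u × V (cycleSub C) w) ⊎ (V Hₚ w × V (cycleSub C) u)) × Type2 D T
    short-HPath-ends with ends-in-first-cycle (ℓ D T) (ℓ≥1 T t≥1 ≤-refl) ≤-refl u∈Hₜ w∈Hₜ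
    ... | u∈ , w∈ with HH-V? (T ∸ 1) (ℓ D (T ∸ 1)) u | HH-V? (T ∸ 1) (ℓ D (T ∸ 1)) w
    ...   | yes u∈Hₚ | yes w∈Hₚ = ⊥-elim (not-both-in-Hₚ u∈Hₚ w∈Hₚ)
    ...   | no  u∉Hₚ | _        = 2≤T w∈Hₚ , inj₂ (w∈Hₚ , u∈C) , CycleEar.not-type1 u∈C u∉Hₚ sʳ w∈
      where
      sʳ : Shortcut w u (reverse R)
      sʳ = Shortcut-reverse s
      u∈C : V (cycleSub C) u
      u∈C = [ ⊥-elim ∘ u∉Hₚ , id ]′ (∈-HH-one⁻ u∈)
      w∈Hₚ : V Hₚ w
      w∈Hₚ = CycleEar.other-end∈Hₚ u∈C u∉Hₚ sʳ w∈
    ...   | yes _    | no  w∉Hₚ = 2≤T u∈Hₚ , inj₁ (u∈Hₚ , w∈C) , CycleEar.not-type1 w∈C w∉Hₚ s u∈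
      where
      w∈C : V (cycleSub C) w
      w∈C = [ ⊥-elim ∘ w∉Hₚ , id ]′ (∈-HH-one⁻ w∈)
      u∈Hₚ : V Hₚ u
      u∈Hₚ = CycleEar.other-end∈Hₚ w∈C w∉Hₚ s u∈

lemma3p5 : (G : Graph) → Girth≥5 G → (D : EarData G) → IsCoarseEarDecomp D →
    (Q : Path G) → PathAvoids (ZZ D (t D) (ℓ D (t D))) Q →
    IsHPath (HH D (t D) (ℓ D (t D))) Q → len Q ≤ 2 →
    2 ≤ t D
    × ((V (HH D (t D ∸ 1) (ℓ D (t D ∸ 1))) (start Q) × V (cycleSub (cyc D (t D))) (end Q))
      ⊎ (V (HH D (t D ∸ 1) (ℓ D (t D ∸ 1))) (end Q) × V (cycleSub (cyc D (t D))) (start Q)))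
    × Type2 D (t D)
lemma3p5 G girth D dc Q Q-avoids Q-HPath len≤2 = short-HPath-ends shortcut
  where
  open NPaths G
  open ShortHPath G girth D dc
  shortcut : Shortcut (start Q) (end Q) (fromPath Q)
  shortcut = record
    { hpath  = IsHPath⇒HPath Q Q-avoids Q-HPath
    ; first≡ = refl
    ; last≡  = fromPath-last Q
    ; size≤2 = len≤2 }
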